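{- Let $m,n\geq 4$ be integers, let $M_{m,n}$ be the generalized M\"{o}bius ladder, and let $L(M_{m,n})$ be its line graph. Then the $M$-polynomial of $L(M_{m,n})$ is $$M(L(M_{m,n});x,y)=2(m-1)x^{4}y^{4}+4(m-1)x^{4}y^{5}+6(m-1)x^{5}y^{6}+6(m-1)(n-3)x^{6}y^{6}.$$
   Context: For a simple connected graph $G$, the degree $d_u$ of a vertex $u$ is the number of edges incident to it. The $M$-polynomial of $G$ is $M(G;x,y)=\sum_{i\leq j}m_{ij}x^{i}y^{j}$, where $m_{ij}$ is the number of edges $(u,v)$ of $G$ whose endpoints have degrees $\{d_u,d_v\}=\{i,j\}$ (with $i\le j$). The line graph $L(G)$ has the edges of $G$ as vertices, two being adjacent in $L(G)$ when they share an endpoint in $G$. Generalized M\"{o}bius ladder $M_{m,n}$: take the Cartesian product $P_m\times P_n$ of the paths $P_m$ with vertices $u_1,\dots,u_m$ and $P_n$ with vertices $v_1,\dots,v_n$. Apply a $180^\circ$ twist: identify the vertex $(u_1,v_j)$ with $(u_m,v_{n+1-j})$ for $j=1,\dots,n$, and identify the edge $((u_1,v_j),(u_1,v_{j+1}))$ with the edge $((u_m,v_{n+1-j}),(u_m,v_{n-j}))$ for $1\le j\le n-1$. Equivalently, its vertex set is $\{1,\dots,m-1\}\times\{1,\dots,n\}$, with edges $(i,j)\sim(i,j+1)$ for $1\le i\le m-1$, $1\le j\le n-1$; $(i,j)\sim(i+1,j)$ for $1\le i\le m-2$, $1\le j\le n$; and $(m-1,j)\sim(1,n+1-j)$ for $1\le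 j\le n$. -}

module Defs where

open import Data.Nat using (ℕ; zero; suc; _+_; _*_; _∸_; _≡ᵇ_; _≤_)
open import Data.Bool using (Bool; true; false; _∧_; _∨_; not)
open import Data.List using (List; []; _∷_; map; filterᵇ; length; concatMap; upTo; _++_)
open import Data.Product using (_×_; _,_; proj₁; proj₂)
open import Relation.Binary.PropositionalEquality using (_≡_)
open import Relation.Nullary.Decidable using (does)
open import Relation.Binary.Definitions using (DecidableEquality)
import Data.Product.Properties as ×P
import Data.Nat.Properties as ℕP

-- Finite simple graphs, given by an explicit duplicate-free list of
-- vertices and a symmetric, irreflexive Boolean adjacency relation.

record Graph : Set₁ where
  field
    V     : Set
    _≟V_  : DecidableEquality V
    verts : List V
    adj   : V → V → Bool

open Graph public

pairs : {A : Set} → List A → List (A × A)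
pairs []       = []
pairs (x ∷ xs) = map (λ y → (x , y)) xs ++ pairs xs

edges : (G : Graph) → List (V G × V G)
edges G = filterᵇ (λ p → adj G (proj₁ p) (proj₂ p)) (pairs (verts G))

deg : (G : Graph) → V G → ℕ
deg G u = length (filterᵇ (adj G u) (verts G))

mCoeff : Graph → ℕ → ℕ → ℕ
mCoeff G i j = length (filterᵇ ok (edges G))
  where
    ok : V G × V G → Bool
    ok (u , v) = ((deg G u ≡ᵇ i) ∧ (deg G v ≡ᵇ j))
               ∨ ((deg G u ≡ᵇ j) ∧ (deg G v ≡ᵇ i))

-- The M-polynomial  M(G;x,y) = Σ_{i ≤ j} m_ij x^i y^j  is represented by
-- its coefficient function (i , j) ↦ m_ij  (for i ≤ j); two such
-- polynomials are equal iff all coefficients with i ≤ j agree.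
MPolyCoeffs : Set
MPolyCoeffs = ℕ → ℕ → ℕ

MPolyEq : MPolyCoeffs → MPolyCoeffs → Set
MPolyEq P Q = ∀ i j → i ≤ j → P i j ≡ Q i j

MPoly : Graph → MPolyCoeffs
MPoly G = mCoeff G

_≡V_ : (G : Graph) → V G → V G → Bool
_≡V_ G a b = does (_≟V_ G a b)

lineGraph : Graph → Graph
lineGraph G = record
  { V     = V G × V G
  ; _≟V_  = ×P.≡-dec (_≟V_ G) (_≟V_ G)
  ; verts = edges G
  ; adj   = λ { (a , b) (c , d) →
                not ((_≡V_ G a c) ∧ (_≡V_ G b d))
                ∧ ((_≡V_ G a c) ∨ (_≡V_ G a d) ∨ (_≡V_ G b c) ∨ (_≡V_ G b d)) }
  }

-- Generalized Möbius ladder M_{m,n}: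
-- vertex set {1..m-1} × {1..n}; edges
--   (i,j) ~ (i,j+1)      1 ≤ i ≤ m-1, 1 ≤ j ≤ n-1
--   (i,j) ~ (i+1,j)      1 ≤ i ≤ m-2, 1 ≤ j ≤ n
--   (m-1,j) ~ (1,n+1-j)  1 ≤ j ≤ n      (the 180° twist)

range1 : ℕ → List ℕ
range1 k = map suc (upTo k)

mobiusVerts : ℕ → ℕ → List (ℕ × ℕ)
mobiusVerts m n = concatMap (λ i → map (λ j → (i , j)) (range1 n)) (range1 (m ∸ 1))

-- directed version of the generating edge rules (only applied to
-- vertices of mobiusVerts, so the index ranges hold automatically)
mobiusArc : ℕ → ℕ → ℕ × ℕ → ℕ × ℕ → Bool
mobiusArc m n (i , j) (k , l) =
     ((i ≡ᵇ k) ∧ (l ≡ᵇ suc j))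
  ∨ ((j ≡ᵇ l) ∧ (k ≡ᵇ suc i))
  ∨ ((i ≡ᵇ m ∸ 1) ∧ (k ≡ᵇ 1) ∧ (l ≡ᵇ (n + 1) ∸ j))

mobiusAdj : ℕ → ℕ → ℕ × ℕ → ℕ × ℕ → Bool
mobiusAdj m n u v = mobiusArc m n u v ∨ mobiusArc m n v u

Mobius : ℕ → ℕ → Graph
Mobius m n = record
  { V     = ℕ × ℕ
  ; _≟V_  = ×P.≡-dec ℕP._≟_ ℕP._≟_
  ; verts = mobiusVerts m n
  ; adj   = mobiusAdj m n
  }

claimedMPoly : ℕ → ℕ → MPolyCoeffs
claimedMPoly m n 4 4 = 2 * (m ∸ 1)
claimedMPoly m n 4 5 = 4 * (m ∸ 1)
claimedMPoly m n 5 6 = 6 * (m ∸ 1)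
claimedMPoly m n 6 6 = 6 * (m ∸ 1) * (n ∸ 3)
claimedMPoly m n _ _ = 0

module Submission where

-- For a simple graph G with a sorted (hence
-- duplicate free) vertex list, two vertices of L(G) are adjacent iff the edges
-- share exactly one endpoint, and an edge uv has degree d(u) + d(v) - 2 in
-- L(G).  With the handshake identity and Kronecker-delta sums over lists this
-- turns 2 · m_pq(L(G)) into a wedge count: the ordered pairs of distinct edges
-- wu , wv at a common vertex w whose line-graph degrees form {p , q}
-- (SimpleGraph.lineGraph-mCoeff).  The second half is about M_{m,n}: its
-- vertices (i , j) fill an (m-1) × n grid, each vertex has two neighbours in
-- the row direction (across the twist at the border), and its degree depends
-- only on its column and is invariant under the twist j ↦ n + 1 - j (Ladder).
-- Hence the wedges at a vertex are a closed formula in its column (Wedges);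
-- summing over columns and rows (Columns) and comparing with the claimed
-- coefficients proves theorem3p2.

open import Data.Nat
open import Data.Nat.Properties
open import Data.Bool using (Bool; true; false; _∧_; _∨_; not; T)
import Data.Bool.Properties as 𝔹
open import Data.List using (List; []; _∷_; [_]; map; filterᵇ; length; concatMap; upTo; applyUpTo; _++_)
open import Data.List.Properties using (upTo-∷ʳ; map-++; length-map; length-applyUpTo)
open import Data.List.Membership.Propositional using (_∈_)
open import Data.List.Relation.Unary.Any using (here; there)
open import Data.List.Relation.Unary.All as All using (All; []; _∷_)
import Data.List.Relation.Unary.All.Properties as AllP
open import Data.List.Relation.Unary.AllPairs as AP using (AllPairs; []; _∷_)
import Data.List.Relation.Unary.AllPairs.Properties as APP
open import Data.Product using (_×_; _,_; proj₁; proj₂)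
import Data.Product.Properties as ×P
open import Data.Sum using (_⊎_; inj₁; inj₂; [_,_]′)
open import Data.Empty using (⊥; ⊥-elim)
open import Data.Unit using (tt)
open import Function using (_∘_; id)
open import Relation.Nullary using (¬_; Dec; does; _because_; ofʸ; yes; no)
open import Relation.Nullary.Decidable using (dec-true; dec-false)
open import Relation.Binary.Definitions using (DecidableEquality)
open import Relation.Binary.PropositionalEquality hiding ([_])
open import Data.Nat.Solver using (module +-*-Solver)
open +-*-Solver using (solve; _:+_; _:*_; _:=_; con)
open import Defs

⟦_⟧ : Bool → ℕ
⟦ true ⟧  = 1
⟦ false ⟧ = 0

∧-false : ∀ {a b : Bool} → (a ≡ true → b ≡ true → ⊥) → (a ∧ b) ≡ false
∧-false {true}  {true}  f = ⊥-elim (f refl refl)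
∧-false {true}  {false} f = refl
∧-false {false}         f = refl

dec-sound : ∀ {P : Set} (d : Dec P) → does d ≡ true → P
dec-sound (true because ofʸ p) _ = p

∧-true : ∀ {a b : Bool} → (a ∧ b) ≡ true → a ≡ true × b ≡ true
∧-true {a} {b} e = 𝔹.∧-conicalˡ a b e , 𝔹.∧-conicalʳ a b e

-- A Boolean identity in four variables, checked on all sixteen inputs.
Bool⁴ : Set
Bool⁴ = Bool → Bool → Bool → Bool → Bool

all𝔹 : (Bool → Bool) → Bool
all𝔹 p = p true ∧ p false

all𝔹-sound : ∀ p → all𝔹 p ≡ true → ∀ x → p x ≡ true
all𝔹-sound p e true  = proj₁ (∧-true e)
all𝔹-sound p e false = proj₂ (∧-true e)

bool⁴ : (f g : Bool⁴) →
  all𝔹 (λ a → all𝔹 (λ b → all𝔹 (λ c → all𝔹 (λ d → does (f a b c d 𝔹.≟ g a b c d))))) ≡ true →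
  ∀ a b c d → f a b c d ≡ g a b c d
bool⁴ f g e a b c d = dec-sound (f a b c d 𝔹.≟ g a b c d)
  (all𝔹-sound (agree a b c) (all𝔹-sound (λ c → all𝔹 (agree a b c))
    (all𝔹-sound (λ b → all𝔹 (λ c → all𝔹 (agree a b c)))
      (all𝔹-sound (λ a → all𝔹 (λ b → all𝔹 (λ c → all𝔹 (agree a b c)))) e a) b) c) d)
  where
    agree : Bool → Bool → Bool → Bool → Bool
    agree a b c d = does (f a b c d 𝔹.≟ g a b c d)

mask : ∀ b {x y} → (b ≡ true → x ≡ y) → ⟦ b ⟧ * x ≡ ⟦ b ⟧ * y
mask true  f = cong (1 *_) (f refl)
mask false f = refl

⟦⟧-idem : ∀ b x → ⟦ b ⟧ * (⟦ b ⟧ * x) ≡ ⟦ b ⟧ * x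
⟦⟧-idem true  x = cong (1 *_) (*-identityˡ x)
⟦⟧-idem false x = refl

⟦not⟧+⟦⟧ : ∀ b → ⟦ not b ⟧ + ⟦ b ⟧ ≡ 1
⟦not⟧+⟦⟧ true  = refl
⟦not⟧+⟦⟧ false = refl

bool-iff : ∀ {a b : Bool} → (a ≡ true → b ≡ true) → (b ≡ true → a ≡ true) → a ≡ b
bool-iff {true}  {true}  f g = refl
bool-iff {true}  {false} f g = sym (f refl)
bool-iff {false} {true}  f g = g refl
bool-iff {false} {false} f g = refl

≡ᵇ-sound : ∀ a b → (a ≡ᵇ b) ≡ true → a ≡ b
≡ᵇ-sound a b e = ≡ᵇ⇒≡ a b (subst T (sym e) tt)

≡ᵇ-true : ∀ a b → a ≡ b → (a ≡ᵇ b) ≡ true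
≡ᵇ-true a b = dec-true (a ≟ b)

≡ᵇ-false : ∀ a b → a ≢ b → (a ≡ᵇ b) ≡ false
≡ᵇ-false a b = dec-false (a ≟ b)

≡ᵇ-sym : ∀ a b → (a ≡ᵇ b) ≡ (b ≡ᵇ a)
≡ᵇ-sym a b = bool-iff (λ e → ≡ᵇ-true b a (sym (≡ᵇ-sound a b e))) (λ e → ≡ᵇ-true a b (sym (≡ᵇ-sound b a e)))

<ᵇ-true : ∀ a b → a < b → (a <ᵇ b) ≡ true
<ᵇ-true a b = dec-true (a <? b)

<ᵇ-sound : ∀ a b → (a <ᵇ b) ≡ true → a < b
<ᵇ-sound a b e = <ᵇ⇒< a b (subst T (sym e) tt)

<ᵇ-false : ∀ a b → ¬ a < b → (a <ᵇ b) ≡ false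
<ᵇ-false a b = dec-false (a <? b)

∨-true : ∀ {a b} → (a ∨ b) ≡ true → a ≡ true ⊎ b ≡ true
∨-true {true}  _ = inj₁ refl
∨-true {false} e = inj₂ e

⟦∧⟧ : ∀ a b → ⟦ a ∧ b ⟧ ≡ ⟦ a ⟧ * ⟦ b ⟧
⟦∧⟧ true  b = sym (+-identityʳ _)
⟦∧⟧ false b = refl

⟦∨⟧ : ∀ a b → (a ≡ true → b ≡ true → ⊥) → ⟦ a ∨ b ⟧ ≡ ⟦ a ⟧ + ⟦ b ⟧
⟦∨⟧ true  true  ex = ⊥-elim (ex refl refl)
⟦∨⟧ true  false ex = refl
⟦∨⟧ false b     ex = refl

⟦∨₃⟧ : ∀ a b c → (a ≡ true → b ≡ true → ⊥) → (a ≡ true → c ≡ true → ⊥) → (b ≡ true → c ≡ true → ⊥) →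
  ⟦ a ∨ b ∨ c ⟧ ≡ ⟦ a ⟧ + (⟦ b ⟧ + ⟦ c ⟧)
⟦∨₃⟧ a b c ab ac bc =
  trans (⟦∨⟧ a (b ∨ c) (λ x y → [ ab x , ac x ]′ (∨-true y))) (cong (⟦ a ⟧ +_) (⟦∨⟧ b c bc))

∑ : {A : Set} → List A → (A → ℕ) → ℕ
∑ []       f = 0
∑ (x ∷ xs) f = f x + ∑ xs f

module _ {A : Set} where

  ∑-cong : ∀ xs {f g : A → ℕ} → (∀ x → f x ≡ g x) → ∑ xs f ≡ ∑ xs g
  ∑-cong []       e = refl
  ∑-cong (x ∷ xs) e = cong₂ _+_ (e x) (∑-cong xs e)

  ∑-cong-All : ∀ {xs} {f g : A → ℕ} → All (λ x → f x ≡ g x) xs → ∑ xs f ≡ ∑ xs g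
  ∑-cong-All []         = refl
  ∑-cong-All (e ∷ es)   = cong₂ _+_ e (∑-cong-All es)

  ∑-cong-∈ : ∀ xs {f g : A → ℕ} → (∀ {x} → x ∈ xs → f x ≡ g x) → ∑ xs f ≡ ∑ xs g
  ∑-cong-∈ xs e = ∑-cong-All (All.tabulate e)

  ∑-zero : ∀ xs → ∑ {A} xs (λ _ → 0) ≡ 0
  ∑-zero []       = refl
  ∑-zero (x ∷ xs) = ∑-zero xs

  ∑-const : ∀ xs c → ∑ {A} xs (λ _ → c) ≡ length xs * c
  ∑-const []       c = refl
  ∑-const (x ∷ xs) c = cong (c +_) (∑-const xs c)

  ∑-+ : ∀ xs (f g : A → ℕ) → ∑ xs (λ x → f x + g x) ≡ ∑ xs f + ∑ xs g
  ∑-+ []       f g = refl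
  ∑-+ (x ∷ xs) f g rewrite ∑-+ xs f g =
    solve 4 (λ a b c d → (a :+ b) :+ (c :+ d) := (a :+ c) :+ (b :+ d)) refl (f x) (g x) (∑ xs f) (∑ xs g)

  ∑-*ˡ : ∀ xs c (f : A → ℕ) → ∑ xs (λ x → c * f x) ≡ c * ∑ xs f
  ∑-*ˡ []       c f = sym (*-zeroʳ c)
  ∑-*ˡ (x ∷ xs) c f rewrite ∑-*ˡ xs c f = sym (*-distribˡ-+ c (f x) _)

  ∑-+₄ : ∀ xs (f₁ f₂ f₃ f₄ : A → ℕ) →
    ∑ xs (λ x → f₁ x + f₂ x + f₃ x + f₄ x) ≡ ∑ xs f₁ + ∑ xs f₂ + ∑ xs f₃ + ∑ xs f₄
  ∑-+₄ xs f₁ f₂ f₃ f₄ =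
    trans (∑-+ xs _ f₄) (cong (_+ ∑ xs f₄) (trans (∑-+ xs _ f₃) (cong (_+ ∑ xs f₃) (∑-+ xs f₁ f₂))))

  ∑-++ : ∀ xs ys (f : A → ℕ) → ∑ (xs ++ ys) f ≡ ∑ xs f + ∑ ys f
  ∑-++ []       ys f = refl
  ∑-++ (x ∷ xs) ys f rewrite ∑-++ xs ys f = sym (+-assoc (f x) _ _)

  ∑-filter : ∀ (P : A → Bool) xs (f : A → ℕ) → ∑ (filterᵇ P xs) f ≡ ∑ xs (λ x → ⟦ P x ⟧ * f x)
  ∑-filter P []       f = refl
  ∑-filter P (x ∷ xs) f with P x
  ... | true  = cong₂ _+_ (sym (+-identityʳ (f x))) (∑-filter P xs f)
  ... | false = ∑-filter P xs f

  length-filter : ∀ (P : A → Bool) xs → length (filterᵇ P xs) ≡ ∑ xs (λ x → ⟦ P x ⟧)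
  length-filter P []       = refl
  length-filter P (x ∷ xs) with P x
  ... | true  = cong suc (length-filter P xs)
  ... | false = length-filter P xs

module _ {A B : Set} where

  ∑-map : ∀ (g : A → B) xs (f : B → ℕ) → ∑ (map g xs) f ≡ ∑ xs (λ x → f (g x))
  ∑-map g []       f = refl
  ∑-map g (x ∷ xs) f = cong (f (g x) +_) (∑-map g xs f)

  ∑-concatMap : ∀ (g : A → List B) xs (f : B → ℕ) → ∑ (concatMap g xs) f ≡ ∑ xs (λ x → ∑ (g x) f)
  ∑-concatMap g []       f = refl
  ∑-concatMap g (x ∷ xs) f = trans (∑-++ (g x) (concatMap g xs) f) (cong (∑ (g x) f +_) (∑-concatMap g xs f))

  ∑-swap : ∀ xs ys (f : A → B → ℕ) → ∑ xs (λ x → ∑ ys (f x)) ≡ ∑ ys (λ y → ∑ xs (λ x → f x y))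
  ∑-swap []       ys f = sym (∑-zero ys)
  ∑-swap (x ∷ xs) ys f = trans (cong (∑ ys (f x) +_) (∑-swap xs ys f)) (sym (∑-+ ys (f x) (λ y → ∑ xs (λ x' → f x' y))))

-- Handshake identity: summing a symmetric R over all ordered pairs counts
-- every unordered pair twice, plus the diagonal.
module _ {A : Set} (R : A → A → ℕ) (R-sym : ∀ x y → R x y ≡ R y x) where

  handshake : ∀ xs → 2 * ∑ (pairs xs) (λ p → R (proj₁ p) (proj₂ p)) + ∑ xs (λ x → R x x) ≡ ∑ xs (λ x → ∑ xs (R x))
  handshake []       = refl
  handshake (x ∷ xs) = begin
      2 * ∑ (map (x ,_) xs ++ pairs xs) F + (R x x + ∑ xs D)
        ≡⟨ cong (λ t → 2 * t + (R x x + ∑ xs D)) (trans (∑-++ (map (x ,_) xs) (pairs xs) F) (cong (_+ P) (∑-map (x ,_) xs F))) ⟩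
      2 * (Rx + P) + (R x x + ∑ xs D)
        ≡⟨ solve 4 (λ a b c d → con 2 :* (a :+ b) :+ (c :+ d) := c :+ a :+ (a :+ (con 2 :* b :+ d))) refl Rx P (R x x) (∑ xs D) ⟩
      R x x + Rx + (Rx + (2 * P + ∑ xs D))
        ≡⟨ cong₂ (λ s t → R x x + Rx + (s + t)) (∑-cong xs (R-sym x)) (handshake xs) ⟩
      R x x + Rx + (∑ xs (λ y → R y x) + ∑ xs (λ y → ∑ xs (R y)))
        ≡⟨ cong (R x x + Rx +_) (sym (∑-+ xs (λ y → R y x) (λ y → ∑ xs (R y)))) ⟩
      R x x + Rx + ∑ xs (λ y → R y x + ∑ xs (R y)) ∎
    where
      open ≡-Reasoning
      F : A × A → ℕ
      F p = R (proj₁ p) (proj₂ p)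
      D : A → ℕ
      D y = R y y
      Rx P : ℕ
      Rx = ∑ xs (R x)
      P  = ∑ (pairs xs) F

  handshake₀ : ∀ xs → (∀ x → R x x ≡ 0) →
    2 * ∑ (pairs xs) (λ p → R (proj₁ p) (proj₂ p)) ≡ ∑ xs (λ x → ∑ xs (R x))
  handshake₀ xs diag = begin
      2 * ∑ (pairs xs) _                        ≡⟨ sym (+-identityʳ _) ⟩
      2 * ∑ (pairs xs) _ + 0                    ≡⟨ cong (2 * ∑ (pairs xs) _ +_) (sym (trans (∑-cong xs diag) (∑-zero xs))) ⟩
      2 * ∑ (pairs xs) _ + ∑ xs (λ x → R x x)   ≡⟨ handshake xs ⟩
      ∑ xs (λ x → ∑ xs (R x))                   ∎
    where open ≡-Reasoning

module _ {A : Set} (_≟_ : DecidableEquality A) where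

  ∑-delta-absent : ∀ {u} xs → All (u ≢_) xs → (h : A → ℕ) → ∑ xs (λ z → ⟦ does (u ≟ z) ⟧ * h z) ≡ 0
  ∑-delta-absent []       []         h = refl
  ∑-delta-absent {u} (x ∷ xs) (u≢x ∷ us) h rewrite dec-false (u ≟ x) u≢x = ∑-delta-absent xs us h

  ∑-delta : ∀ {u xs} → AllPairs _≢_ xs → u ∈ xs → (h : A → ℕ) → ∑ xs (λ z → ⟦ does (u ≟ z) ⟧ * h z) ≡ h u
  ∑-delta {u} {x ∷ xs} (x≢ ∷ _) (here refl) h rewrite dec-true (u ≟ u) refl =
    trans (cong₂ _+_ (+-identityʳ (h u)) (∑-delta-absent xs x≢ h)) (+-identityʳ (h u))
  ∑-delta {u} {x ∷ xs} (x≢ ∷ xs!) (there u∈) h rewrite dec-false (u ≟ x) (λ u≡x → All.lookup x≢ u∈ (sym u≡x)) =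
    ∑-delta xs! u∈ h

degreesAre : ℕ → ℕ → ℕ → ℕ → Bool
degreesAre i j x y = ((x ≡ᵇ i) ∧ (y ≡ᵇ j)) ∨ ((x ≡ᵇ j) ∧ (y ≡ᵇ i))

degreesAre-sym : ∀ i j x y → degreesAre i j x y ≡ degreesAre i j y x
degreesAre-sym i j x y = bool⁴ (λ a b c d → (a ∧ b) ∨ (c ∧ d)) (λ a b c d → (d ∧ c) ∨ (b ∧ a)) refl
  (x ≡ᵇ i) (y ≡ᵇ j) (x ≡ᵇ j) (y ≡ᵇ i)

-- Two edges ab and cd, known through the comparisons a=c, a=d, b=c, b=d,
-- are distinct and share an endpoint.
shareOne : Bool⁴
shareOne ac ad bc bd = not (ac ∧ bd) ∧ not (ad ∧ bc) ∧ (ac ∨ ad ∨ bc ∨ bd)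

shareOne-swap : ∀ ac ad bc bd → shareOne ac ad bc bd ≡ shareOne ad ac bd bc
shareOne-swap = bool⁴ _ _ refl

-- the line-graph test of Defs omits the case a=d, b=c of a reversed copy
shareOne-reduce : ∀ ac ad bc bd → (ad ∧ bc) ≡ false →
  not (ac ∧ bd) ∧ (ac ∨ ad ∨ bc ∨ bd) ≡ shareOne ac ad bc bd
shareOne-reduce ac true  true  bd ()
shareOne-reduce ac true  false bd _ = refl
shareOne-reduce ac false bc    bd _ = refl

-- For edges ab, cd with a ≠ b and c ≠ d, "share exactly one endpoint"
-- splits into the four disjoint ways of choosing the common endpoint.
shareOne-split : ∀ ac ad bc bd → (ac ∧ ad) ≡ false → (ac ∧ bc) ≡ false → (ad ∧ bd) ≡ false → (bc ∧ bd) ≡ false →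
  ⟦ shareOne ac ad bc bd ⟧ ≡ ⟦ ac ⟧ * ⟦ not bd ⟧ + ⟦ ad ⟧ * ⟦ not bc ⟧ + ⟦ bc ⟧ * ⟦ not ad ⟧ + ⟦ bd ⟧ * ⟦ not ac ⟧
shareOne-split true  true  _     _     () _  _  _
shareOne-split true  false true  _     _  () _  _
shareOne-split true  false false true  _  _  _  _  = refl
shareOne-split true  false false false _  _  _  _  = refl
shareOne-split false true  _     true  _  _  () _
shareOne-split false true  true  false _  _  _  _  = refl
shareOne-split false true  false false _  _  _  _  = refl
shareOne-split false false true  true  _  _  _  ()
shareOne-split false false true  false _  _  _  _  = refl
shareOne-split false false false true  _  _  _  _  = refl
shareOne-split false false false false _  _  _  _  = refl

masked-split : ∀ (b ac ad bc bd : Bool) x →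
  (b ≡ true → (ac ∧ ad) ≡ false × (ac ∧ bc) ≡ false × (ad ∧ bd) ≡ false × (bc ∧ bd) ≡ false) →
  ⟦ b ⟧ * (⟦ shareOne ac ad bc bd ⟧ * x) ≡
  ⟦ ac ⟧ * (⟦ b ⟧ * (⟦ not bd ⟧ * x)) + ⟦ ad ⟧ * (⟦ b ⟧ * (⟦ not bc ⟧ * x)) +
  ⟦ bc ⟧ * (⟦ b ⟧ * (⟦ not ad ⟧ * x)) + ⟦ bd ⟧ * (⟦ b ⟧ * (⟦ not ac ⟧ * x))
masked-split false ac ad bc bd x _ =
  solve 4 (λ a b c d → con 0 := a :* con 0 :+ b :* con 0 :+ c :* con 0 :+ d :* con 0) refl ⟦ ac ⟧ ⟦ ad ⟧ ⟦ bc ⟧ ⟦ bd ⟧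
masked-split true ac ad bc bd x excl =
  let (e₁ , e₂ , e₃ , e₄) = excl refl in
  trans (cong (λ t → 1 * (t * x)) (shareOne-split ac ad bc bd e₁ e₂ e₃ e₄))
        (solve 9 (λ a b c d a' b' c' d' x → con 1 :* ((a :* a' :+ b :* b' :+ c :* c' :+ d :* d') :* x)
                   := a :* (con 1 :* (a' :* x)) :+ b :* (con 1 :* (b' :* x)) :+ c :* (con 1 :* (c' :* x)) :+ d :* (con 1 :* (d' :* x)))
               refl ⟦ ac ⟧ ⟦ ad ⟧ ⟦ bc ⟧ ⟦ bd ⟧ ⟦ not bd ⟧ ⟦ not bc ⟧ ⟦ not ad ⟧ ⟦ not ac ⟧ x)

pairs-All : ∀ {A : Set} {P : A → Set} {R : A → A → Set} {xs} → All P xs → AllPairs R xs →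
  All (λ e → (P (proj₁ e) × P (proj₂ e)) × R (proj₁ e) (proj₂ e)) (pairs xs)
pairs-All []         []         = []
pairs-All {P = P} {R} {x ∷ xs} (px ∷ pxs) (rx ∷ rxs) = AllP.++⁺ (AllP.map⁺ (with-x pxs rx)) (pairs-All pxs rxs)
  where
    with-x : ∀ {ys} → All P ys → All (R x) ys → All (λ y → (P x × P y) × R x y) ys
    with-x []       []       = []
    with-x (p ∷ ps) (r ∷ rs) = ((px , p) , r) ∷ with-x ps rs

-- The line graph of a simple graph whose vertex list is sorted by an
-- asymmetric relation R (hence duplicate free).
module SimpleGraph
  (G : Graph)
  (adj-sym : ∀ u v → adj G u v ≡ adj G v u)
  (adj-irr : ∀ u → adj G u u ≡ false)
  {R : V G → V G → Set} (R-asym : ∀ {x y} → R x y → R y x → ⊥)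
  (sorted : AllPairs R (verts G))
  where

  private
    W : Set
    W = V G

  Vs : List W
  Vs = verts G

  LG : Graph
  LG = lineGraph G

  eq : W → W → Bool
  eq = _≡V_ G

  eq-sound : ∀ {u v} → eq u v ≡ true → u ≡ v
  eq-sound {u} {v} = dec-sound (_≟V_ G u v)

  eq-refl : ∀ u → eq u u ≡ true
  eq-refl u = dec-true (_≟V_ G u u) refl

  eq-sym : ∀ u v → eq u v ≡ eq v u
  eq-sym u v = bool-iff (λ e → dec-true (_≟V_ G v u) (sym (eq-sound e))) (λ e → dec-true (_≟V_ G u v) (sym (eq-sound e)))

  A : W → W → ℕ
  A u v = ⟦ adj G u v ⟧

  A-sym : ∀ u v → A u v ≡ A v u
  A-sym u v = cong ⟦_⟧ (adj-sym u v)

  A-diag : ∀ u → A u u ≡ 0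
  A-diag u = cong ⟦_⟧ (adj-irr u)

  adj⇒≢ : ∀ {u v} → adj G u v ≡ true → u ≢ v
  adj⇒≢ {u} a refl with () ← trans (sym a) (adj-irr u)

  distinct : AllPairs _≢_ Vs
  distinct = AP.map (λ r e → R-asym r (subst₂ R e (sym e) r)) sorted

  delta : ∀ {u} → u ∈ Vs → (h : W → ℕ) → ∑ Vs (λ z → ⟦ eq u z ⟧ * h z) ≡ h u
  delta = ∑-delta (_≟V_ G) distinct

  deg-∑ : ∀ u → deg G u ≡ ∑ Vs (A u)
  deg-∑ u = length-filter (adj G u) Vs

  Candidate : W × W → Set
  Candidate e = (proj₁ e ∈ Vs × proj₂ e ∈ Vs) × R (proj₁ e) (proj₂ e)

  candidates : All Candidate (pairs Vs)
  candidates = pairs-All (All.tabulate (λ x∈ → x∈)) sorted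

  A₂ : W × W → ℕ
  A₂ e = A (proj₁ e) (proj₂ e)

  ∑-edges : ∀ (F : W × W → ℕ) → ∑ (edges G) F ≡ ∑ (pairs Vs) (λ e → A₂ e * F e)
  ∑-edges = ∑-filter (λ e → adj G (proj₁ e) (proj₂ e)) (pairs Vs)

  ∑-candidates : ∀ (F : W → W → ℕ) → (∀ a b → F a b ≡ F b a) →
    2 * ∑ (pairs Vs) (λ e → A₂ e * F (proj₁ e) (proj₂ e)) ≡ ∑ Vs (λ a → ∑ Vs (λ b → A a b * F a b))
  ∑-candidates F F-sym = handshake₀ (λ a b → A a b * F a b) (λ a b → cong₂ _*_ (A-sym a b) (F-sym a b)) Vs
                                    (λ a → cong (_* F a a) (A-diag a))

  meets : W × W → W × W → Bool
  meets (a , b) (c , d) = shareOne (eq a c) (eq a d) (eq b c) (eq b d)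

  lineAdj-meets : ∀ e f → Candidate e → Candidate f → adj LG e f ≡ meets e f
  lineAdj-meets (a , b) (c , d) (_ , Rab) (_ , Rcd) =
    shareOne-reduce (eq a c) (eq a d) (eq b c) (eq b d)
      (∧-false (λ a=d b=c → R-asym Rab (subst₂ R (sym (eq-sound b=c)) (sym (eq-sound a=d)) Rcd)))

  lineAdj-sym : ∀ e f → adj LG e f ≡ adj LG f e
  lineAdj-sym (a , b) (c , d) rewrite eq-sym c a | eq-sym c b | eq-sym d a | eq-sym d b =
    bool⁴ (λ ac ad bc bd → not (ac ∧ bd) ∧ (ac ∨ ad ∨ bc ∨ bd)) (λ ac ad bc bd → not (ac ∧ bd) ∧ (ac ∨ bc ∨ ad ∨ bd))
          refl (eq a c) (eq a d) (eq b c) (eq b d)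

  lineAdj-irr : ∀ e → adj LG e e ≡ false
  lineAdj-irr (a , b) rewrite eq-refl a | eq-refl b = refl

  others : W → W → (W → W → ℕ) → ℕ
  others u v g = ∑ Vs (λ z → A u z * (⟦ not (eq v z) ⟧ * g u z))

  others-cong : ∀ u v {g g' : W → W → ℕ} → (∀ x y → g x y ≡ g' x y) → others u v g ≡ others u v g'
  others-cong u v e = ∑-cong Vs (λ z → cong (λ t → A u z * (⟦ not (eq v z) ⟧ * t)) (e u z))

  -- The ordered adjacent pairs (w , z) whose edge meets uv in exactly one
  -- endpoint: each edge at u or at v (other than uv) occurs twice.
  meets-around : ∀ {u v} → u ∈ Vs → v ∈ Vs → u ≢ v → (g : W → W → ℕ) → (∀ w z → g w z ≡ g z w) →
    ∑ Vs (λ w → ∑ Vs (λ z → A w z * (⟦ meets (u , v) (w , z) ⟧ * g w z))) ≡ 2 * (others u v g + others v u g)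
  meets-around {u} {v} u∈ v∈ u≢v g g-sym = begin
      ∑ Vs (λ w → ∑ Vs (λ z → A w z * (⟦ meets (u , v) (w , z) ⟧ * g w z)))
        ≡⟨ ∑-cong Vs (λ w → trans (∑-cong Vs (split w)) (∑-+₄ Vs (t₁ w) (t₂ w) (t₃ w) (t₄ w))) ⟩
      ∑ Vs (λ w → ∑ Vs (t₁ w) + ∑ Vs (t₂ w) + ∑ Vs (t₃ w) + ∑ Vs (t₄ w))
        ≡⟨ ∑-+₄ Vs _ _ _ _ ⟩
      ∑ Vs (λ w → ∑ Vs (t₁ w)) + ∑ Vs (λ w → ∑ Vs (t₂ w)) + ∑ Vs (λ w → ∑ Vs (t₃ w)) + ∑ Vs (λ w → ∑ Vs (t₄ w))
        ≡⟨ cong₂ _+_ (cong₂ _+_ (cong₂ _+_ (at-first u∈ v) (at-second u∈ v)) (at-first v∈ u)) (at-second v∈ u) ⟩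
      others u v g + others u v g + others v u g + others v u g
        ≡⟨ solve 2 (λ a b → a :+ a :+ b :+ b := con 2 :* (a :+ b)) refl (others u v g) (others v u g) ⟩
      2 * (others u v g + others v u g) ∎
    where
      open ≡-Reasoning
      t₁ t₂ t₃ t₄ : W → W → ℕ
      t₁ w z = ⟦ eq u w ⟧ * (A w z * (⟦ not (eq v z) ⟧ * g w z))
      t₂ w z = ⟦ eq u z ⟧ * (A w z * (⟦ not (eq v w) ⟧ * g w z))
      t₃ w z = ⟦ eq v w ⟧ * (A w z * (⟦ not (eq u z) ⟧ * g w z))
      t₄ w z = ⟦ eq v z ⟧ * (A w z * (⟦ not (eq u w) ⟧ * g w z))

      split : ∀ w z → A w z * (⟦ meets (u , v) (w , z) ⟧ * g w z) ≡ t₁ w z + t₂ w z + t₃ w z + t₄ w z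
      split w z = masked-split (adj G w z) (eq u w) (eq u z) (eq v w) (eq v z) (g w z) (λ a →
        let w≢z = adj⇒≢ a in
        ∧-false (λ x y → w≢z (trans (sym (eq-sound x)) (eq-sound y))) ,
        ∧-false (λ x y → u≢v (trans (eq-sound x) (sym (eq-sound y)))) ,
        ∧-false (λ x y → u≢v (trans (eq-sound x) (sym (eq-sound y)))) ,
        ∧-false (λ x y → w≢z (trans (sym (eq-sound x)) (eq-sound y))))

      at-first : ∀ {x} → x ∈ Vs → ∀ y →
        ∑ Vs (λ w → ∑ Vs (λ z → ⟦ eq x w ⟧ * (A w z * (⟦ not (eq y z) ⟧ * g w z)))) ≡ others x y g
      at-first {x} x∈ y = trans (∑-cong Vs (λ w → ∑-*ˡ Vs ⟦ eq x w ⟧ _))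
                                (delta x∈ (λ w → ∑ Vs (λ z → A w z * (⟦ not (eq y z) ⟧ * g w z))))

      at-second : ∀ {x} → x ∈ Vs → ∀ y →
        ∑ Vs (λ w → ∑ Vs (λ z → ⟦ eq x z ⟧ * (A w z * (⟦ not (eq y w) ⟧ * g w z)))) ≡ others x y g
      at-second {x} x∈ y = begin
          ∑ Vs (λ w → ∑ Vs (λ z → ⟦ eq x z ⟧ * (A w z * (⟦ not (eq y w) ⟧ * g w z))))
            ≡⟨ ∑-swap Vs Vs _ ⟩
          ∑ Vs (λ z → ∑ Vs (λ w → ⟦ eq x z ⟧ * (A w z * (⟦ not (eq y w) ⟧ * g w z))))
            ≡⟨ ∑-cong Vs (λ z → ∑-*ˡ Vs ⟦ eq x z ⟧ _) ⟩
          ∑ Vs (λ z → ⟦ eq x z ⟧ * ∑ Vs (λ w → A w z * (⟦ not (eq y w) ⟧ * g w z)))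
            ≡⟨ delta x∈ (λ z → ∑ Vs (λ w → A w z * (⟦ not (eq y w) ⟧ * g w z))) ⟩
          ∑ Vs (λ w → A w x * (⟦ not (eq y w) ⟧ * g w x))
            ≡⟨ ∑-cong Vs (λ w → cong₂ (λ s t → s * (⟦ not (eq y w) ⟧ * t)) (A-sym w x) (g-sym w x)) ⟩
          others x y g ∎

  meets-edges : ∀ {u v} → Candidate (u , v) → adj G u v ≡ true → (g : W → W → ℕ) → (∀ w z → g w z ≡ g z w) →
    ∑ (pairs Vs) (λ f → A₂ f * (⟦ meets (u , v) f ⟧ * g (proj₁ f) (proj₂ f))) ≡ others u v g + others v u g
  meets-edges {u} {v} ((u∈ , v∈) , _) a g g-sym = *-cancelˡ-≡ _ _ 2 (trans
    (∑-candidates (λ w z → ⟦ meets (u , v) (w , z) ⟧ * g w z)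
                  (λ w z → cong₂ _*_ (cong ⟦_⟧ (shareOne-swap (eq u w) (eq u z) (eq v w) (eq v z))) (g-sym w z)))
    (meets-around u∈ v∈ (adj⇒≢ a) g g-sym))

  others-all : ∀ {u v} → v ∈ Vs → (g : W → W → ℕ) → others u v g + A u v * g u v ≡ ∑ Vs (λ z → A u z * g u z)
  others-all {u} {v} v∈ g = begin
      others u v g + A u v * g u v
        ≡⟨ cong (others u v g +_) (sym (delta v∈ (λ z → A u z * g u z))) ⟩
      others u v g + ∑ Vs (λ z → ⟦ eq v z ⟧ * (A u z * g u z))
        ≡⟨ sym (∑-+ Vs _ _) ⟩
      ∑ Vs (λ z → A u z * (⟦ not (eq v z) ⟧ * g u z) + ⟦ eq v z ⟧ * (A u z * g u z))
        ≡⟨ ∑-cong Vs (λ z → recombine (A u z) (eq v z) (g u z)) ⟩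
      ∑ Vs (λ z → A u z * g u z) ∎
    where
      open ≡-Reasoning
      recombine : ∀ a b x → a * (⟦ not b ⟧ * x) + ⟦ b ⟧ * (a * x) ≡ a * x
      recombine a b x = trans (solve 4 (λ a c d x → a :* (c :* x) :+ d :* (a :* x) := a :* ((c :+ d) :* x)) refl a ⟦ not b ⟧ ⟦ b ⟧ x)
                              (trans (cong (λ t → a * (t * x)) (⟦not⟧+⟦⟧ b)) (cong (a *_) (+-identityʳ x)))

  others-deg : ∀ {u v} → v ∈ Vs → adj G u v ≡ true → others u v (λ _ _ → 1) + 1 ≡ deg G u
  others-deg {u} {v} v∈ a = begin
      others u v (λ _ _ → 1) + 1             ≡⟨ cong (others u v (λ _ _ → 1) +_) (cong (λ b → ⟦ b ⟧ * 1) (sym a)) ⟩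
      others u v (λ _ _ → 1) + A u v * 1     ≡⟨ others-all v∈ (λ _ _ → 1) ⟩
      ∑ Vs (λ z → A u z * 1)                 ≡⟨ ∑-cong Vs (λ z → *-identityʳ (A u z)) ⟩
      ∑ Vs (A u)                             ≡⟨ sym (deg-∑ u) ⟩
      deg G u                                ∎
    where open ≡-Reasoning

  lineDegree : W → W → ℕ
  lineDegree u v = deg G u + deg G v ∸ 2

  lineDegree-sym : ∀ u v → lineDegree u v ≡ lineDegree v u
  lineDegree-sym u v = cong (_∸ 2) (+-comm (deg G u) (deg G v))

  -- the degree of an edge uv in L(G): d(u) - 1 other edges at u, d(v) - 1 at v
  deg-line : ∀ {u v} → Candidate (u , v) → adj G u v ≡ true → deg LG (u , v) ≡ lineDegree u v
  deg-line {u} {v} c@((u∈ , v∈) , _) a = begin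
      deg LG (u , v)
        ≡⟨ length-filter (adj LG (u , v)) (edges G) ⟩
      ∑ (edges G) (λ f → ⟦ adj LG (u , v) f ⟧)
        ≡⟨ ∑-edges _ ⟩
      ∑ (pairs Vs) (λ f → A₂ f * ⟦ adj LG (u , v) f ⟧)
        ≡⟨ ∑-cong-All (All.map (λ {f} cf → cong (λ t → A₂ f * t)
             (trans (cong ⟦_⟧ (lineAdj-meets (u , v) f c cf)) (sym (*-identityʳ _)))) candidates) ⟩
      ∑ (pairs Vs) (λ f → A₂ f * (⟦ meets (u , v) f ⟧ * 1))
        ≡⟨ meets-edges c a (λ _ _ → 1) (λ _ _ → refl) ⟩
      Xu + Xv
        ≡⟨ sym (m+n∸n≡m (Xu + Xv) 2) ⟩
      Xu + Xv + 2 ∸ 2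
        ≡⟨ cong (_∸ 2) (trans (solve 2 (λ x y → x :+ y :+ con 2 := (x :+ con 1) :+ (y :+ con 1)) refl Xu Xv)
                              (cong₂ _+_ (others-deg v∈ a) (others-deg u∈ (trans (adj-sym v u) a)))) ⟩
      lineDegree u v ∎
    where
      open ≡-Reasoning
      Xu Xv : ℕ
      Xu = others u v (λ _ _ → 1)
      Xv = others v u (λ _ _ → 1)

  wedgeCount : ℕ → ℕ → ℕ
  wedgeCount p q = ∑ Vs (λ w → ∑ Vs (λ u → A w u * others w u (λ x y → ⟦ degreesAre p q (lineDegree w u) (lineDegree x y) ⟧)))

  -- Adjacent vertices of L(G) are pairs of edges with a common endpoint, so
  -- (twice) the M-polynomial coefficients of L(G) are wedge counts of G.
  module _ (p q : ℕ) where

    private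
      P : List (W × W)
      P = pairs Vs

      γ : W → W → W → W → ℕ
      γ u v x y = ⟦ degreesAre p q (lineDegree u v) (lineDegree x y) ⟧

      γ-sym : ∀ u v x y → γ u v x y ≡ γ u v y x
      γ-sym u v x y = cong (λ t → ⟦ degreesAre p q (lineDegree u v) t ⟧) (lineDegree-sym x y)

      γ-swap : ∀ u v x y → γ u v x y ≡ γ v u x y
      γ-swap u v x y = cong (λ t → ⟦ degreesAre p q t (lineDegree x y) ⟧) (lineDegree-sym u v)

      Y : W → W → ℕ
      Y u v = others u v (γ u v) + others v u (γ u v)

      Y-sym : ∀ u v → Y u v ≡ Y v u
      Y-sym u v = trans (cong₂ _+_ (others-cong u v (γ-swap u v)) (others-cong v u (γ-swap u v))) (+-comm (others u v (γ v u)) (others v u (γ v u)))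

      R₀ : W × W → W × W → ℕ
      R₀ e f = ⟦ adj LG e f ⟧ * ⟦ degreesAre p q (deg LG e) (deg LG f) ⟧

      R₀-sym : ∀ e f → R₀ e f ≡ R₀ f e
      R₀-sym e f = cong₂ _*_ (cong ⟦_⟧ (lineAdj-sym e f)) (cong ⟦_⟧ (degreesAre-sym p q (deg LG e) (deg LG f)))

      R₀-edges : ∀ e f → Candidate e → Candidate f →
        adj G (proj₁ e) (proj₂ e) ≡ true → adj G (proj₁ f) (proj₂ f) ≡ true →
        R₀ e f ≡ ⟦ meets e f ⟧ * γ (proj₁ e) (proj₂ e) (proj₁ f) (proj₂ f)
      R₀-edges e f ce cf ae af = cong₂ _*_ (cong ⟦_⟧ (lineAdj-meets e f ce cf))
        (cong₂ (λ s t → ⟦ degreesAre p q s t ⟧) (deg-line ce ae) (deg-line cf af))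

      edge-sum : 2 * mCoeff LG p q ≡ ∑ P (λ e → A₂ e * Y (proj₁ e) (proj₂ e))
      edge-sum = begin
          2 * mCoeff LG p q
            ≡⟨ cong (2 *_) (trans (length-filter _ (edges LG)) (∑-filter (λ ef → adj LG (proj₁ ef) (proj₂ ef)) (pairs (edges G)) _)) ⟩
          2 * ∑ (pairs (edges G)) (λ ef → R₀ (proj₁ ef) (proj₂ ef))
            ≡⟨ handshake₀ R₀ R₀-sym (edges G) (λ e → cong (_* ⟦ degreesAre p q (deg LG e) (deg LG e) ⟧) (cong ⟦_⟧ (lineAdj-irr e))) ⟩
          ∑ (edges G) (λ e → ∑ (edges G) (R₀ e))
            ≡⟨ trans (∑-edges _) (∑-cong P (λ e → cong (A₂ e *_) (∑-edges (R₀ e)))) ⟩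
          ∑ P (λ e → A₂ e * ∑ P (λ f → A₂ f * R₀ e f))
            ≡⟨ ∑-cong-All (All.map (λ {e} ce → mask (adj G (proj₁ e) (proj₂ e)) (λ ae →
                 trans (∑-cong-All (All.map (λ {f} cf → mask (adj G (proj₁ f) (proj₂ f)) (λ af → R₀-edges e f ce cf ae af)) candidates))
                       (meets-edges ce ae (γ (proj₁ e) (proj₂ e)) (γ-sym (proj₁ e) (proj₂ e))))) candidates) ⟩
          ∑ P (λ e → A₂ e * Y (proj₁ e) (proj₂ e)) ∎
        where open ≡-Reasoning

      both-ends : ∑ Vs (λ a → ∑ Vs (λ b → A a b * Y a b)) ≡ wedgeCount p q + wedgeCount p q
      both-ends = begin
          ∑ Vs (λ a → ∑ Vs (λ b → A a b * Y a b))
            ≡⟨ ∑-cong Vs (λ a → trans (∑-cong Vs (λ b → *-distribˡ-+ (A a b) _ _)) (∑-+ Vs _ _)) ⟩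
          ∑ Vs (λ a → ∑ Vs (λ b → A a b * others a b (γ a b)) + ∑ Vs (λ b → A a b * others b a (γ a b)))
            ≡⟨ ∑-+ Vs _ _ ⟩
          wedgeCount p q + ∑ Vs (λ a → ∑ Vs (λ b → A a b * others b a (γ a b)))
            ≡⟨ cong (wedgeCount p q +_) (trans (∑-swap Vs Vs _)
                 (∑-cong Vs (λ b → ∑-cong Vs (λ a → cong₂ _*_ (A-sym a b) (others-cong b a (γ-swap a b)))))) ⟩
          wedgeCount p q + wedgeCount p q ∎
        where open ≡-Reasoning

    lineGraph-mCoeff : 2 * mCoeff LG p q ≡ wedgeCount p q
    lineGraph-mCoeff = *-cancelˡ-≡ _ _ 2 (begin
        2 * (2 * mCoeff LG p q)                          ≡⟨ cong (2 *_) edge-sum ⟩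
        2 * ∑ P (λ e → A₂ e * Y (proj₁ e) (proj₂ e))     ≡⟨ ∑-candidates Y Y-sym ⟩
        ∑ Vs (λ a → ∑ Vs (λ b → A a b * Y a b))          ≡⟨ both-ends ⟩
        wedgeCount p q + wedgeCount p q                  ≡⟨ cong (wedgeCount p q +_) (sym (+-identityʳ _)) ⟩
        2 * wedgeCount p q                               ∎)
      where open ≡-Reasoning

  wedges-at : ∀ w (g : W → W → ℕ) →
    ∑ Vs (λ u → A w u * others w u (λ _ z → g u z)) + ∑ Vs (λ u → A w u * g u u) ≡ ∑ Vs (λ u → A w u * ∑ Vs (λ z → A w z * g u z))
  wedges-at w g = trans (sym (∑-+ Vs _ _)) (∑-cong-∈ Vs at-u)
    where
      at-u : ∀ {u} → u ∈ Vs → A w u * others w u (λ _ z → g u z) + A w u * g u u ≡ A w u * ∑ Vs (λ z → A w z * g u z)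
      at-u {u} u∈ = begin
          A w u * others w u (λ _ z → g u z) + A w u * g u u
            ≡⟨ cong (A w u * others w u (λ _ z → g u z) +_) (sym (⟦⟧-idem (adj G w u) (g u u))) ⟩
          A w u * others w u (λ _ z → g u z) + A w u * (A w u * g u u)
            ≡⟨ sym (*-distribˡ-+ (A w u) _ _) ⟩
          A w u * (others w u (λ _ z → g u z) + A w u * g u u)
            ≡⟨ cong (A w u *_) (others-all u∈ (λ _ z → g u z)) ⟩
          A w u * ∑ Vs (λ z → A w z * g u z) ∎
        where open ≡-Reasoning

inRange : ℕ → ℕ → Bool
inRange zero    N = false
inRange (suc c) N = c <ᵇ N

inRange-true : ∀ c N → 1 ≤ c → c ≤ N → inRange c N ≡ true
inRange-true (suc c) N _ c≤N = <ᵇ-true c N c≤N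

range1-snoc : ∀ N → range1 (suc N) ≡ range1 N ++ [ suc N ]
range1-snoc N = trans (cong (map suc) (sym (upTo-∷ʳ N))) (map-++ suc (upTo N) [ N ])

range1-All : ∀ N → All (λ j → 1 ≤ j × j ≤ N) (range1 N)
range1-All N = AllP.map⁺ (AllP.applyUpTo⁺₁ id N (λ i<N → s≤s z≤n , i<N))

range1-sorted : ∀ N → AllPairs _<_ (range1 N)
range1-sorted N = APP.map⁺ (APP.applyUpTo⁺₁ id N (λ i<j _ → s≤s i<j))

∑-range1-delta : ∀ N c (g : ℕ → ℕ) → ∑ (range1 N) (λ j → ⟦ c ≡ᵇ j ⟧ * g j) ≡ ⟦ inRange c N ⟧ * g c
∑-range1-delta zero    zero    g = refl
∑-range1-delta zero    (suc c) g = refl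
∑-range1-delta (suc N) c g = begin
    ∑ (range1 (suc N)) F                   ≡⟨ cong (λ l → ∑ l F) (range1-snoc N) ⟩
    ∑ (range1 N ++ [ suc N ]) F            ≡⟨ ∑-++ (range1 N) [ suc N ] F ⟩
    ∑ (range1 N) F + (F (suc N) + 0)       ≡⟨ cong₂ _+_ (∑-range1-delta N c g) (+-identityʳ _) ⟩
    ⟦ inRange c N ⟧ * g c + ⟦ c ≡ᵇ suc N ⟧ * g (suc N) ≡⟨ extend c ⟩
    ⟦ inRange c (suc N) ⟧ * g c            ∎
  where
    open ≡-Reasoning
    F : ℕ → ℕ
    F j = ⟦ c ≡ᵇ j ⟧ * g j
    extend : ∀ c → ⟦ inRange c N ⟧ * g c + ⟦ c ≡ᵇ suc N ⟧ * g (suc N) ≡ ⟦ inRange c (suc N) ⟧ * g c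
    extend zero = refl
    extend (suc c) with c ≟ N
    ... | yes refl rewrite <ᵇ-false c c (n≮n c) | ≡ᵇ-true c c refl | <ᵇ-true c (suc c) (n<1+n c) = refl
    ... | no c≢N rewrite ≡ᵇ-false c N c≢N =
      trans (+-identityʳ _) (cong (λ b → ⟦ b ⟧ * g (suc c)) (bool-iff
        (λ e → <ᵇ-true c (suc N) (m<n⇒m<1+n (<ᵇ-sound c N e)))
        (λ e → <ᵇ-true c N (≤∧≢⇒< (s≤s⁻¹ (<ᵇ-sound c (suc N) e)) c≢N))))

-- Grid points (i , j): row i, column j

Pt : Set
Pt = ℕ × ℕ

eqPt : Pt → Pt → Bool
eqPt a b = does (×P.≡-dec _≟_ _≟_ a b)

eqPt-coords : ∀ a b c d → eqPt (a , b) (c , d) ≡ (a ≡ᵇ c) ∧ (b ≡ᵇ d)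
eqPt-coords a b c d = bool-iff
  (λ e → let q = dec-sound (×P.≡-dec _≟_ _≟_ (a , b) (c , d)) e in
         cong₂ _∧_ (≡ᵇ-true a c (×P.,-injectiveˡ q)) (≡ᵇ-true b d (×P.,-injectiveʳ q)))
  (λ e → let (e₁ , e₂) = ∧-true {a ≡ᵇ c} {b ≡ᵇ d} e in
         dec-true (×P.≡-dec _≟_ _≟_ (a , b) (c , d)) (cong₂ _,_ (≡ᵇ-sound a c e₁) (≡ᵇ-sound b d e₂)))

Lex : Pt → Pt → Set
Lex a b = proj₁ a < proj₁ b ⊎ (proj₁ a ≡ proj₁ b × proj₂ a < proj₂ b)

Lex-asym : ∀ {a b} → Lex a b → Lex b a → ⊥
Lex-asym (inj₁ x)       (inj₁ y)       = <-asym x y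
Lex-asym (inj₁ x)       (inj₂ (e , _)) = <-irrefl (sym e) x
Lex-asym (inj₂ (e , _)) (inj₁ y)       = <-irrefl (sym e) y
Lex-asym (inj₂ (_ , x)) (inj₂ (_ , y)) = <-asym x y

module Grid (m n : ℕ) where

  M : ℕ
  M = m ∸ 1

  Vs : List Pt
  Vs = mobiusVerts m n

  InGrid : Pt → Set
  InGrid p = (1 ≤ proj₁ p × proj₁ p ≤ M) × (1 ≤ proj₂ p × proj₂ p ≤ n)

  grid-All : All InGrid Vs
  grid-All = AllP.concat⁺ (AllP.map⁺ (All.map (λ ri → AllP.map⁺ (All.map (ri ,_) (range1-All n))) (range1-All M)))

  grid-sorted : AllPairs Lex Vs
  grid-sorted = APP.concat⁺
    (AllP.map⁺ (All.universal (λ i → APP.map⁺ (AP.map (λ lt → inj₂ (refl , lt)) (range1-sorted n))) _))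
    (APP.map⁺ (AP.map (λ lt → AllP.map⁺ (All.universal (λ _ → AllP.map⁺ (All.universal (λ _ → inj₁ lt) _)) _)) (range1-sorted M)))

  ∑-grid : (f : Pt → ℕ) → ∑ Vs f ≡ ∑ (range1 M) (λ i → ∑ (range1 n) (λ j → f (i , j)))
  ∑-grid f = trans (∑-concatMap (λ i → map (i ,_) (range1 n)) (range1 M) f)
                   (∑-cong (range1 M) (λ i → ∑-map (i ,_) (range1 n) f))

  ∑-grid-delta : ∀ a b (h : Pt → ℕ) → ∑ Vs (λ z → ⟦ eqPt (a , b) z ⟧ * h z) ≡ ⟦ inRange a M ⟧ * (⟦ inRange b n ⟧ * h (a , b))
  ∑-grid-delta a b h = begin
      ∑ Vs (λ z → ⟦ eqPt (a , b) z ⟧ * h z)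
        ≡⟨ ∑-grid _ ⟩
      ∑ (range1 M) (λ i → ∑ (range1 n) (λ j → ⟦ eqPt (a , b) (i , j) ⟧ * h (i , j)))
        ≡⟨ ∑-cong (range1 M) (λ i → trans (∑-cong (range1 n) (λ j → coords i j)) (∑-*ˡ (range1 n) ⟦ a ≡ᵇ i ⟧ _)) ⟩
      ∑ (range1 M) (λ i → ⟦ a ≡ᵇ i ⟧ * ∑ (range1 n) (λ j → ⟦ b ≡ᵇ j ⟧ * h (i , j)))
        ≡⟨ ∑-cong (range1 M) (λ i → cong (⟦ a ≡ᵇ i ⟧ *_) (∑-range1-delta n b (λ j → h (i , j)))) ⟩
      ∑ (range1 M) (λ i → ⟦ a ≡ᵇ i ⟧ * (⟦ inRange b n ⟧ * h (i , b)))
        ≡⟨ ∑-range1-delta M a (λ i → ⟦ inRange b n ⟧ * h (i , b)) ⟩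
      ⟦ inRange a M ⟧ * (⟦ inRange b n ⟧ * h (a , b)) ∎
    where
      open ≡-Reasoning
      coords : ∀ i j → ⟦ eqPt (a , b) (i , j) ⟧ * h (i , j) ≡ ⟦ a ≡ᵇ i ⟧ * (⟦ b ≡ᵇ j ⟧ * h (i , j))
      coords i j rewrite eqPt-coords a b i j | ⟦∧⟧ (a ≡ᵇ i) (b ≡ᵇ j) = *-assoc ⟦ a ≡ᵇ i ⟧ ⟦ b ≡ᵇ j ⟧ (h (i , j))

module Ladder (m n : ℕ) (m4 : 4 ≤ m) where
  open Grid m n public

  -- with at least three rows the twist and row arcs never coincide
  M≥3 : 3 ≤ M
  M≥3 = ∸-monoˡ-≤ 1 m4

  M≢1 : M ≢ 1
  M≢1 e = <-irrefl (sym e) (≤-trans (s≤s (s≤s z≤n)) M≥3)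

  M≢2 : M ≢ 2
  M≢2 e = <-irrefl (sym e) M≥3

  A : Pt → Pt → ℕ
  A u z = ⟦ mobiusAdj m n u z ⟧

  module Arcs (i j k l : ℕ) where

    col⁺ row⁺ tw⁺ col⁻ row⁻ tw⁻ : Bool
    col⁺ = (i ≡ᵇ k) ∧ (l ≡ᵇ suc j)
    row⁺ = (j ≡ᵇ l) ∧ (k ≡ᵇ suc i)
    tw⁺  = (i ≡ᵇ m ∸ 1) ∧ (k ≡ᵇ 1) ∧ (l ≡ᵇ (n + 1) ∸ j)
    col⁻ = (k ≡ᵇ i) ∧ (j ≡ᵇ suc l)
    row⁻ = (l ≡ᵇ j) ∧ (i ≡ᵇ suc k)
    tw⁻  = (k ≡ᵇ m ∸ 1) ∧ (i ≡ᵇ 1) ∧ (j ≡ᵇ (n + 1) ∸ l)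

    col⁺→ : col⁺ ≡ true → k ≡ i × l ≡ suc j
    col⁺→ e = let (a , b) = ∧-true {i ≡ᵇ k} e in sym (≡ᵇ-sound i k a) , ≡ᵇ-sound l (suc j) b
    row⁺→ : row⁺ ≡ true → l ≡ j × k ≡ suc i
    row⁺→ e = let (a , b) = ∧-true {j ≡ᵇ l} e in sym (≡ᵇ-sound j l a) , ≡ᵇ-sound k (suc i) b
    tw⁺→ : tw⁺ ≡ true → i ≡ M × k ≡ 1
    tw⁺→ e = let (a , b) = ∧-true {i ≡ᵇ M} e in ≡ᵇ-sound i M a , ≡ᵇ-sound k 1 (proj₁ (∧-true {k ≡ᵇ 1} b))
    col⁻→ : col⁻ ≡ true → k ≡ i × j ≡ suc l
    col⁻→ e = let (a , b) = ∧-true {k ≡ᵇ i} e in ≡ᵇ-sound k i a , ≡ᵇ-sound j (suc l) b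
    row⁻→ : row⁻ ≡ true → l ≡ j × i ≡ suc k
    row⁻→ e = let (a , b) = ∧-true {l ≡ᵇ j} e in ≡ᵇ-sound l j a , ≡ᵇ-sound i (suc k) b
    tw⁻→ : tw⁻ ≡ true → k ≡ M × i ≡ 1
    tw⁻→ e = let (a , b) = ∧-true {k ≡ᵇ M} e in ≡ᵇ-sound k M a , ≡ᵇ-sound i 1 (proj₁ (∧-true {i ≡ᵇ 1} b))

    Excl : Bool → Bool → Set
    Excl a b = a ≡ true → b ≡ true → ⊥

    module Exclusive (1≤i : 1 ≤ i) (1≤k : 1 ≤ k) where
      c⁺r⁺ : Excl col⁺ row⁺
      c⁺r⁺ a b = m≢1+n+m i {0} (trans (sym (proj₁ (col⁺→ a))) (proj₂ (row⁺→ b)))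
      c⁺t⁺ : Excl col⁺ tw⁺
      c⁺t⁺ a b = M≢1 (trans (sym (proj₁ (tw⁺→ b))) (trans (sym (proj₁ (col⁺→ a))) (proj₂ (tw⁺→ b))))
      r⁺t⁺ : Excl row⁺ tw⁺
      r⁺t⁺ a b with () ← subst (1 ≤_) (suc-injective (trans (sym (proj₂ (row⁺→ a))) (proj₂ (tw⁺→ b)))) 1≤i
      c⁻r⁻ : Excl col⁻ row⁻
      c⁻r⁻ a b = m≢1+n+m k {0} (trans (proj₁ (col⁻→ a)) (proj₂ (row⁻→ b)))
      c⁻t⁻ : Excl col⁻ tw⁻
      c⁻t⁻ a b = M≢1 (trans (sym (proj₁ (tw⁻→ b))) (trans (proj₁ (col⁻→ a)) (proj₂ (tw⁻→ b))))
      r⁻t⁻ : Excl row⁻ tw⁻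
      r⁻t⁻ a b with () ← subst (1 ≤_) (suc-injective (trans (sym (proj₂ (row⁻→ a))) (proj₂ (tw⁻→ b)))) 1≤k

      forward-backward : Excl (col⁺ ∨ row⁺ ∨ tw⁺) (col⁻ ∨ row⁻ ∨ tw⁻)
      forward-backward a b with ∨-true {col⁺} a | ∨-true {col⁻} b
      ... | inj₁ p | inj₁ q = m≢1+n+m j {1} (trans (proj₂ (col⁻→ q)) (cong suc (proj₂ (col⁺→ p))))
      ... | inj₁ p | inj₂ q with ∨-true {row⁻} q
      ...   | inj₁ q' = m≢1+n+m k {0} (trans (proj₁ (col⁺→ p)) (proj₂ (row⁻→ q')))
      ...   | inj₂ q' = M≢1 (trans (sym (proj₁ (tw⁻→ q'))) (trans (proj₁ (col⁺→ p)) (proj₂ (tw⁻→ q'))))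
      forward-backward a b | inj₂ p | inj₁ q with ∨-true {row⁺} p
      ...   | inj₁ p' = m≢1+n+m i {0} (trans (sym (proj₁ (col⁻→ q))) (proj₂ (row⁺→ p')))
      ...   | inj₂ p' = M≢1 (trans (sym (proj₁ (tw⁺→ p'))) (trans (sym (proj₁ (col⁻→ q))) (proj₂ (tw⁺→ p'))))
      forward-backward a b | inj₂ p | inj₂ q with ∨-true {row⁺} p | ∨-true {row⁻} q
      ... | inj₁ p' | inj₁ q' = m≢1+n+m k {1} (trans (proj₂ (row⁺→ p')) (cong suc (proj₂ (row⁻→ q'))))
      ... | inj₁ p' | inj₂ q' = M≢2 (trans (sym (proj₁ (tw⁻→ q'))) (trans (proj₂ (row⁺→ p')) (cong suc (proj₂ (tw⁻→ q')))))
      ... | inj₂ p' | inj₁ q' = M≢2 (trans (sym (proj₁ (tw⁺→ p'))) (trans (proj₂ (row⁻→ q')) (cong suc (proj₂ (tw⁺→ p')))))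
      ... | inj₂ p' | inj₂ q' = M≢1 (trans (sym (proj₁ (tw⁺→ p'))) (proj₂ (tw⁻→ q')))

      ⟦adj⟧ : A (i , j) (k , l) ≡ (⟦ col⁺ ⟧ + (⟦ row⁺ ⟧ + ⟦ tw⁺ ⟧)) + (⟦ col⁻ ⟧ + (⟦ row⁻ ⟧ + ⟦ tw⁻ ⟧))
      ⟦adj⟧ = trans (⟦∨⟧ (col⁺ ∨ row⁺ ∨ tw⁺) (col⁻ ∨ row⁻ ∨ tw⁻) forward-backward)
                    (cong₂ _+_ (⟦∨₃⟧ col⁺ row⁺ tw⁺ c⁺r⁺ c⁺t⁺ r⁺t⁺) (⟦∨₃⟧ col⁻ row⁻ tw⁻ c⁻r⁻ c⁻t⁻ r⁻t⁻))

    mirror-test : 1 ≤ j → j ≤ n → 1 ≤ l → l ≤ n → (j ≡ᵇ (n + 1) ∸ l) ≡ ((n + 1) ∸ j ≡ᵇ l)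
    mirror-test 1≤j j≤n 1≤l l≤n = bool-iff
      (λ e → ≡ᵇ-true ((n + 1) ∸ j) l (trans (cong ((n + 1) ∸_) (≡ᵇ-sound j ((n + 1) ∸ l) e)) (m∸[m∸n]≡n (≤-trans l≤n (m≤m+n n 1)))))
      (λ e → ≡ᵇ-true j ((n + 1) ∸ l) (trans (sym (m∸[m∸n]≡n (≤-trans j≤n (m≤m+n n 1)))) (cong ((n + 1) ∸_) (≡ᵇ-sound ((n + 1) ∸ j) l e))))

    col⁺-δ : ⟦ col⁺ ⟧ ≡ ⟦ eqPt (i , suc j) (k , l) ⟧
    col⁺-δ rewrite eqPt-coords i (suc j) k l | ≡ᵇ-sym l (suc j) = refl
    row⁺-δ : ⟦ row⁺ ⟧ ≡ ⟦ eqPt (suc i , j) (k , l) ⟧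
    row⁺-δ rewrite eqPt-coords (suc i) j k l | ≡ᵇ-sym k (suc i) = cong ⟦_⟧ (𝔹.∧-comm (j ≡ᵇ l) _)
    tw⁺-δ : ⟦ tw⁺ ⟧ ≡ ⟦ i ≡ᵇ M ⟧ * ⟦ eqPt (1 , (n + 1) ∸ j) (k , l) ⟧
    tw⁺-δ rewrite eqPt-coords 1 ((n + 1) ∸ j) k l | ≡ᵇ-sym k 1 | ≡ᵇ-sym l ((n + 1) ∸ j) = ⟦∧⟧ (i ≡ᵇ M) _
    col⁻-δ : 1 ≤ j → ⟦ col⁻ ⟧ ≡ ⟦ eqPt (i , j ∸ 1) (k , l) ⟧
    col⁻-δ (s≤s {n = j'} _) rewrite eqPt-coords i j' k l | ≡ᵇ-sym k i = refl
    row⁻-δ : 1 ≤ i → ⟦ row⁻ ⟧ ≡ ⟦ eqPt (i ∸ 1 , j) (k , l) ⟧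
    row⁻-δ (s≤s {n = i'} _) rewrite eqPt-coords i' j k l | ≡ᵇ-sym l j = cong ⟦_⟧ (𝔹.∧-comm (j ≡ᵇ l) _)
    tw⁻-δ : 1 ≤ j → j ≤ n → 1 ≤ l → l ≤ n → ⟦ tw⁻ ⟧ ≡ ⟦ i ≡ᵇ 1 ⟧ * ⟦ eqPt (M , (n + 1) ∸ j) (k , l) ⟧
    tw⁻-δ 1≤j j≤n 1≤l l≤n rewrite eqPt-coords M ((n + 1) ∸ j) k l | ≡ᵇ-sym k M | mirror-test 1≤j j≤n 1≤l l≤n =
      trans (cong ⟦_⟧ (bool⁴ (λ x y z _ → x ∧ y ∧ z) (λ x y z _ → y ∧ x ∧ z) refl (M ≡ᵇ k) (i ≡ᵇ 1) ((n + 1) ∸ j ≡ᵇ l) true))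
            (⟦∧⟧ (i ≡ᵇ 1) _)

  δ∑ : Pt → (Pt → ℕ) → ℕ
  δ∑ p h = ∑ Vs (λ z → ⟦ eqPt p z ⟧ * h z)

  ∑-neighbours : ∀ i j → InGrid (i , j) → (h : Pt → ℕ) → ∑ Vs (λ z → A (i , j) z * h z) ≡
    (δ∑ (i , suc j) h + (δ∑ (suc i , j) h + ⟦ i ≡ᵇ M ⟧ * δ∑ (1 , (n + 1) ∸ j) h))
    + (δ∑ (i , j ∸ 1) h + (δ∑ (i ∸ 1 , j) h + ⟦ i ≡ᵇ 1 ⟧ * δ∑ (M , (n + 1) ∸ j) h))
  ∑-neighbours i j ((1≤i , _) , (1≤j , j≤n)) h = begin
      ∑ Vs (λ z → A (i , j) z * h z)
        ≡⟨ ∑-cong-All (All.map (λ {z} z∈ → pointwise (proj₁ z) (proj₂ z) z∈) grid-All) ⟩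
      ∑ Vs (λ z → (t₁ z + (t₂ z + ⟦ i ≡ᵇ M ⟧ * t₃ z)) + (t₄ z + (t₅ z + ⟦ i ≡ᵇ 1 ⟧ * t₆ z)))
        ≡⟨ ∑-+ Vs _ _ ⟩
      ∑ Vs (λ z → t₁ z + (t₂ z + ⟦ i ≡ᵇ M ⟧ * t₃ z)) + ∑ Vs (λ z → t₄ z + (t₅ z + ⟦ i ≡ᵇ 1 ⟧ * t₆ z))
        ≡⟨ cong₂ _+_ (split₃ t₁ t₂ t₃ ⟦ i ≡ᵇ M ⟧) (split₃ t₄ t₅ t₆ ⟦ i ≡ᵇ 1 ⟧) ⟩
      _ ∎
    where
      open ≡-Reasoning
      t₁ t₂ t₃ t₄ t₅ t₆ : Pt → ℕ
      t₁ z = ⟦ eqPt (i , suc j) z ⟧ * h z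
      t₂ z = ⟦ eqPt (suc i , j) z ⟧ * h z
      t₃ z = ⟦ eqPt (1 , (n + 1) ∸ j) z ⟧ * h z
      t₄ z = ⟦ eqPt (i , j ∸ 1) z ⟧ * h z
      t₅ z = ⟦ eqPt (i ∸ 1 , j) z ⟧ * h z
      t₆ z = ⟦ eqPt (M , (n + 1) ∸ j) z ⟧ * h z

      split₃ : ∀ (f g f' : Pt → ℕ) c → ∑ Vs (λ z → f z + (g z + c * f' z)) ≡ ∑ Vs f + (∑ Vs g + c * ∑ Vs f')
      split₃ f g f' c = trans (∑-+ Vs f _) (cong (∑ Vs f +_) (trans (∑-+ Vs g _) (cong (∑ Vs g +_) (∑-*ˡ Vs c f'))))

      pointwise : ∀ k l → InGrid (k , l) → A (i , j) (k , l) * h (k , l) ≡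
        (t₁ (k , l) + (t₂ (k , l) + ⟦ i ≡ᵇ M ⟧ * t₃ (k , l))) + (t₄ (k , l) + (t₅ (k , l) + ⟦ i ≡ᵇ 1 ⟧ * t₆ (k , l)))
      pointwise k l ((1≤k , _) , (1≤l , l≤n)) = begin
          A (i , j) (k , l) * h (k , l)
            ≡⟨ cong (_* h (k , l)) (Exclusive.⟦adj⟧ 1≤i 1≤k) ⟩
          ((⟦ col⁺ ⟧ + (⟦ row⁺ ⟧ + ⟦ tw⁺ ⟧)) + (⟦ col⁻ ⟧ + (⟦ row⁻ ⟧ + ⟦ tw⁻ ⟧))) * h (k , l)
            ≡⟨ cong (_* h (k , l)) (cong₂ _+_ (cong₂ _+_ col⁺-δ (cong₂ _+_ row⁺-δ tw⁺-δ))
                                              (cong₂ _+_ (col⁻-δ 1≤j) (cong₂ _+_ (row⁻-δ 1≤i) (tw⁻-δ 1≤j j≤n 1≤l l≤n)))) ⟩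
          ((e₁ + (e₂ + ⟦ i ≡ᵇ M ⟧ * e₃)) + (e₄ + (e₅ + ⟦ i ≡ᵇ 1 ⟧ * e₆))) * h (k , l)
            ≡⟨ solve 9 (λ a b c d e f g k x → ((a :+ (b :+ c :* d)) :+ (e :+ (f :+ g :* k))) :* x
                         := (a :* x :+ (b :* x :+ c :* (d :* x))) :+ (e :* x :+ (f :* x :+ g :* (k :* x))))
                 refl e₁ e₂ ⟦ i ≡ᵇ M ⟧ e₃ e₄ e₅ ⟦ i ≡ᵇ 1 ⟧ e₆ (h (k , l)) ⟩
          _ ∎
        where
          open Arcs i j k l
          e₁ e₂ e₃ e₄ e₅ e₆ : ℕ
          e₁ = ⟦ eqPt (i , suc j) (k , l) ⟧
          e₂ = ⟦ eqPt (suc i , j) (k , l) ⟧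
          e₃ = ⟦ eqPt (1 , (n + 1) ∸ j) (k , l) ⟧
          e₄ = ⟦ eqPt (i , j ∸ 1) (k , l) ⟧
          e₅ = ⟦ eqPt (i ∸ 1 , j) (k , l) ⟧
          e₆ = ⟦ eqPt (M , (n + 1) ∸ j) (k , l) ⟧

  Mirror : (ℕ → ℕ) → Set
  Mirror g = ∀ l → 1 ≤ l → l ≤ n → g ((n + 1) ∸ l) ≡ g l

  mirror-range : ∀ j → 1 ≤ j → j ≤ n → 1 ≤ (n + 1) ∸ j × (n + 1) ∸ j ≤ n
  mirror-range j 1≤j j≤n rewrite +-∸-comm 1 j≤n =
    subst (_≤ n ∸ j + 1) (+-identityˡ 1) (+-monoˡ-≤ 1 z≤n) ,
    subst (n ∸ j + 1 ≤_) (m∸n+n≡m (≤-trans 1≤j j≤n)) (+-monoˡ-≤ 1 (∸-monoʳ-≤ n 1≤j))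

  left-column : ∀ j → 1 ≤ j → j ≤ n → inRange (j ∸ 1) n ≡ (1 <ᵇ j)
  left-column (suc zero)    _ _   = refl
  left-column (suc (suc x)) _ j≤n = <ᵇ-true x n (≤-trans (n≤1+n (suc x)) j≤n)

  -- in the row direction every vertex has two neighbours (possibly across the twist)
  two-rows : ∀ i → 1 ≤ i → i ≤ M → ⟦ i <ᵇ M ⟧ + ⟦ i ≡ᵇ M ⟧ + ⟦ inRange (i ∸ 1) M ⟧ + ⟦ i ≡ᵇ 1 ⟧ ≡ 2
  two-rows (suc zero) _ _ rewrite <ᵇ-true 1 M (≤-trans (s≤s (s≤s z≤n)) M≥3) | ≡ᵇ-false 1 M (M≢1 ∘ sym) = refl
  two-rows (suc (suc i)) _ i≤M with suc (suc i) ≟ M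
  ... | yes i=M rewrite ≡ᵇ-true _ M i=M | <ᵇ-false (suc (suc i)) M (λ i<M → <-irrefl i=M i<M) | <ᵇ-true i M (≤-trans (n≤1+n (suc i)) i≤M) = refl
  ... | no  i≢M rewrite ≡ᵇ-false _ M i≢M | <ᵇ-true (suc (suc i)) M (≤∧≢⇒< i≤M i≢M) | <ᵇ-true i M (≤-trans (n≤1+n (suc i)) i≤M) = refl

  N : ℕ → (ℕ → ℕ) → ℕ
  N j g = ⟦ j <ᵇ n ⟧ * g (suc j) + ⟦ 1 <ᵇ j ⟧ * g (j ∸ 1) + 2 * g j

  ∑-neighbours-column : ∀ i j → InGrid (i , j) → (g : ℕ → ℕ) → Mirror g →
    ∑ Vs (λ z → A (i , j) z * g (proj₂ z)) ≡ N j g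
  ∑-neighbours-column i j u@((1≤i , i≤M) , (1≤j , j≤n)) g g-mirror
    rewrite ∑-neighbours i j u (g ∘ proj₂)
          | ∑-grid-delta i (suc j) (g ∘ proj₂) | ∑-grid-delta (suc i) j (g ∘ proj₂) | ∑-grid-delta 1 ((n + 1) ∸ j) (g ∘ proj₂)
          | ∑-grid-delta i (j ∸ 1) (g ∘ proj₂) | ∑-grid-delta (i ∸ 1) j (g ∘ proj₂) | ∑-grid-delta M ((n + 1) ∸ j) (g ∘ proj₂)
          | inRange-true i M 1≤i i≤M | inRange-true j n 1≤j j≤n | inRange-true 1 M (s≤s z≤n) (≤-trans (s≤s z≤n) M≥3)
          | inRange-true M M (≤-trans (s≤s z≤n) M≥3) ≤-refl
          | inRange-true ((n + 1) ∸ j) n (proj₁ (mirror-range j 1≤j j≤n)) (proj₂ (mirror-range j 1≤j j≤n))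
          | g-mirror j 1≤j j≤n | left-column j 1≤j j≤n
    = trans (collect ⟦ j <ᵇ n ⟧ ⟦ 1 <ᵇ j ⟧ ⟦ i <ᵇ M ⟧ ⟦ i ≡ᵇ M ⟧ ⟦ inRange (i ∸ 1) M ⟧ ⟦ i ≡ᵇ 1 ⟧ (g (suc j)) (g (j ∸ 1)) (g j))
            (cong (λ t → ⟦ j <ᵇ n ⟧ * g (suc j) + ⟦ 1 <ᵇ j ⟧ * g (j ∸ 1) + t * g j) (two-rows i 1≤i i≤M))
    where
      collect : ∀ a b c d e f x y z →
        (1 * (a * x) + (c * (1 * z) + d * (1 * (1 * z)))) + (1 * (b * y) + (e * (1 * z) + f * (1 * (1 * z))))
        ≡ a * x + b * y + (c + d + e + f) * z
      collect = solve 9 (λ a b c d e f x y z →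
        (con 1 :* (a :* x) :+ (c :* (con 1 :* z) :+ d :* (con 1 :* (con 1 :* z)))) :+ (con 1 :* (b :* y) :+ (e :* (con 1 :* z) :+ f :* (con 1 :* (con 1 :* z))))
        := a :* x :+ b :* y :+ (c :+ d :+ e :+ f) :* z) refl

  colDeg : ℕ → ℕ
  colDeg l = ⟦ l <ᵇ n ⟧ + ⟦ 1 <ᵇ l ⟧ + 2

  deg-grid : ∀ u → InGrid u → deg (Mobius m n) u ≡ colDeg (proj₂ u)
  deg-grid (i , j) u = begin
      deg (Mobius m n) (i , j)                 ≡⟨ length-filter (mobiusAdj m n (i , j)) Vs ⟩
      ∑ Vs (A (i , j))                         ≡⟨ ∑-cong Vs (λ z → sym (*-identityʳ _)) ⟩
      ∑ Vs (λ z → A (i , j) z * 1)             ≡⟨ ∑-neighbours-column i j u (λ _ → 1) (λ _ _ _ → refl) ⟩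
      ⟦ j <ᵇ n ⟧ * 1 + ⟦ 1 <ᵇ j ⟧ * 1 + 2      ≡⟨ cong₂ (λ a b → a + b + 2) (*-identityʳ ⟦ j <ᵇ n ⟧) (*-identityʳ ⟦ 1 <ᵇ j ⟧) ⟩
      colDeg j                                 ∎
    where open ≡-Reasoning

  colDeg-mirror : Mirror colDeg
  colDeg-mirror (suc l) _ l<n rewrite +-comm n 1 =
    trans (cong₂ (λ a b → ⟦ a ⟧ + ⟦ b ⟧ + 2) (∸-<ᵇ n l l<n) (1<ᵇ∸ n l)) (cong (_+ 2) (+-comm ⟦ 0 <ᵇ l ⟧ _))
    where
      ∸-<ᵇ : ∀ n l → l < n → (n ∸ l <ᵇ n) ≡ (0 <ᵇ l)
      ∸-<ᵇ n zero    _   = <ᵇ-false n n (n≮n n)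
      ∸-<ᵇ n (suc l) l<n = <ᵇ-true (n ∸ suc l) n (∸-monoʳ-< {n} {suc l} {0} z<s (<⇒≤ l<n))
      1<ᵇ∸ : ∀ n l → (1 <ᵇ n ∸ l) ≡ (suc l <ᵇ n)
      1<ᵇ∸ n       zero    = refl
      1<ᵇ∸ zero    (suc l) = refl
      1<ᵇ∸ (suc n) (suc l) = 1<ᵇ∸ n l

  adj-irr : ∀ u → mobiusAdj m n u u ≡ false
  adj-irr (i , j) = 𝔹.¬-not no-loop
    where
      open Arcs i j i j
      no-loop : mobiusAdj m n (i , j) (i , j) ≡ true → ⊥
      no-loop a with ∨-true {col⁺ ∨ row⁺ ∨ tw⁺} a
      ... | inj₁ f with ∨-true {col⁺} f
      ...   | inj₁ p = m≢1+n+m j {0} (proj₂ (col⁺→ p))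
      ...   | inj₂ q with ∨-true {row⁺} q
      ...     | inj₁ p = m≢1+n+m i {0} (proj₂ (row⁺→ p))
      ...     | inj₂ p = M≢1 (trans (sym (proj₁ (tw⁺→ p))) (proj₂ (tw⁺→ p)))
      no-loop a | inj₂ b with ∨-true {col⁻} b
      ...   | inj₁ p = m≢1+n+m j {0} (proj₂ (col⁻→ p))
      ...   | inj₂ q with ∨-true {row⁻} q
      ...     | inj₁ p = m≢1+n+m i {0} (proj₂ (row⁻→ p))
      ...     | inj₂ p = M≢1 (trans (sym (proj₁ (tw⁻→ p))) (proj₂ (tw⁻→ p)))

-- At a vertex of column j let β₁ , β₂ ∈ {0 , 1} say
-- whether there is a right, resp. left, neighbour column, and let φxy weigh a
-- pair of edges towards the columns x , y ∈ {d , a , c} (right, left, own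
-- column; two neighbours lie in the own column).  The weighted number of
-- ordered pairs of distinct edges at that vertex is
colProfile : (β₁ β₂ φda φdc φad φac φcd φca φcc : ℕ) → ℕ
colProfile β₁ β₂ φda φdc φad φac φcd φca φcc =
  β₁ * β₂ * φda + 2 * β₁ * φdc + β₁ * β₂ * φad + 2 * β₂ * φac + 2 * β₁ * φcd + 2 * β₂ * φca + 2 * φcc

-- all ordered pairs of edges = distinct pairs + equal pairs
colProfile-pairs : ∀ (b₁ b₂ : Bool) (φdd φda φdc φad φaa φac φcd φca φcc : ℕ) → let β₁ = ⟦ b₁ ⟧ ; β₂ = ⟦ b₂ ⟧ in
  colProfile β₁ β₂ φda φdc φad φac φcd φca φcc + (β₁ * φdd + β₂ * φaa + 2 * φcc)
  ≡ β₁ * (β₁ * φdd + β₂ * φda + 2 * φdc) + β₂ * (β₁ * φad + β₂ * φaa + 2 * φac) + 2 * (β₁ * φcd + β₂ * φca + 2 * φcc)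
colProfile-pairs b₁ b₂ φdd φda φdc φad φaa φac φcd φca φcc = begin
    colProfile β₁ β₂ φda φdc φad φac φcd φca φcc + (β₁ * φdd + β₂ * φaa + 2 * φcc)
      ≡⟨ cong₂ (λ s t → colProfile β₁ β₂ φda φdc φad φac φcd φca φcc + (s + t + 2 * φcc)) (sym (⟦⟧-idem b₁ φdd)) (sym (⟦⟧-idem b₂ φaa)) ⟩
    colProfile β₁ β₂ φda φdc φad φac φcd φca φcc + (β₁ * (β₁ * φdd) + β₂ * (β₂ * φaa) + 2 * φcc)
      ≡⟨ solve 11 (λ β₁ β₂ dd da dc ad aa ac cd ca cc →
           β₁ :* β₂ :* da :+ con 2 :* β₁ :* dc :+ β₁ :* β₂ :* ad :+ con 2 :* β₂ :* ac :+ con 2 :* β₁ :* cd :+ con 2 :* β₂ :* ca :+ con 2 :* cc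
             :+ (β₁ :* (β₁ :* dd) :+ β₂ :* (β₂ :* aa) :+ con 2 :* cc)
           := β₁ :* (β₁ :* dd :+ β₂ :* da :+ con 2 :* dc) :+ β₂ :* (β₁ :* ad :+ β₂ :* aa :+ con 2 :* ac) :+ con 2 :* (β₁ :* cd :+ β₂ :* ca :+ con 2 :* cc))
           refl β₁ β₂ φdd φda φdc φad φaa φac φcd φca φcc ⟩
    β₁ * (β₁ * φdd + β₂ * φda + 2 * φdc) + β₂ * (β₁ * φad + β₂ * φaa + 2 * φac) + 2 * (β₁ * φcd + β₂ * φca + 2 * φcc) ∎
  where
    open ≡-Reasoning
    β₁ β₂ : ℕ
    β₁ = ⟦ b₁ ⟧
    β₂ = ⟦ b₂ ⟧

-- colProfile at the five kinds of columns (first and last, next to them,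
-- inner), the weights being equal up to the symmetry of degree pairs
end-shape : ∀ x x' y → x' ≡ x → colProfile 1 0 x' x' x y x y y ≡ 4 * x + 2 * y
end-shape x .x y refl = solve 2 (λ x y →
  con 1 :* con 0 :* x :+ con 2 :* con 1 :* x :+ con 1 :* con 0 :* x :+ con 2 :* con 0 :* y :+ con 2 :* con 1 :* x :+ con 2 :* con 0 :* y :+ con 2 :* y
  := con 4 :* x :+ con 2 :* y) refl x y

end-shape′ : ∀ r s t u x x' y → x' ≡ x → colProfile 0 1 r s t x' u x y ≡ 4 * x + 2 * y
end-shape′ r s t u x .x y refl = solve 6 (λ r s t u x y →
  con 0 :* con 1 :* r :+ con 2 :* con 0 :* s :+ con 0 :* con 1 :* t :+ con 2 :* con 1 :* x :+ con 2 :* con 0 :* u :+ con 2 :* con 1 :* x :+ con 2 :* y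
  := con 4 :* x :+ con 2 :* y) refl r s t u x y

near-shape : ∀ x x' y → x' ≡ x → colProfile 1 1 x' y x x y x' y ≡ 6 * x + 6 * y
near-shape x .x y refl = solve 2 (λ x y →
  con 1 :* con 1 :* x :+ con 2 :* con 1 :* y :+ con 1 :* con 1 :* x :+ con 2 :* con 1 :* x :+ con 2 :* con 1 :* y :+ con 2 :* con 1 :* x :+ con 2 :* y
  := con 6 :* x :+ con 6 :* y) refl x y

near-shape′ : ∀ x x' y → x' ≡ x → colProfile 1 1 x x x' y x' y y ≡ 6 * x + 6 * y
near-shape′ x .x y refl = solve 2 (λ x y →
  con 1 :* con 1 :* x :+ con 2 :* con 1 :* x :+ con 1 :* con 1 :* x :+ con 2 :* con 1 :* y :+ con 2 :* con 1 :* x :+ con 2 :* con 1 :* y :+ con 2 :* y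
  := con 6 :* x :+ con 6 :* y) refl x y

inner-shape : ∀ y → colProfile 1 1 y y y y y y y ≡ 12 * y
inner-shape = solve 1 (λ y →
  con 1 :* con 1 :* y :+ con 2 :* con 1 :* y :+ con 1 :* con 1 :* y :+ con 2 :* con 1 :* y :+ con 2 :* con 1 :* y :+ con 2 :* con 1 :* y :+ con 2 :* y
  := con 12 :* y) refl

-- The wedge count at a vertex of degree c whose right and left neighbour
-- columns exist (b₁ , b₂) and have degrees d and a; φ x y is the weight
-- of a pair of edges towards vertices of degrees x and y.
colShape : (p q : ℕ) → Bool → Bool → (c a d : ℕ) → ℕ
colShape p q b₁ b₂ c a d = colProfile ⟦ b₁ ⟧ ⟦ b₂ ⟧ (φ d a) (φ d c) (φ a d) (φ a c) (φ c d) (φ c a) (φ c c)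
  where
    φ : ℕ → ℕ → ℕ
    φ x y = ⟦ degreesAre p q (c + x ∸ 2) (c + y ∸ 2) ⟧

colShape-cong : ∀ p q {b₁ b₁' b₂ b₂' c c' a a' d d'} → b₁ ≡ b₁' → b₂ ≡ b₂' → c ≡ c' → a ≡ a' → d ≡ d' →
  colShape p q b₁ b₂ c a d ≡ colShape p q b₁' b₂' c' a' d'
colShape-cong p q refl refl refl refl refl = refl

module Wedges (m n : ℕ) (m4 : 4 ≤ m) (p q : ℕ) where
  open Ladder m n m4
  module LG = SimpleGraph (Mobius m n) (λ u v → 𝔹.∨-comm (mobiusArc m n u v) _) adj-irr Lex-asym grid-sorted

  ψ : ℕ → ℕ → ℕ → ℕ
  ψ j x y = ⟦ degreesAre p q (colDeg j + x ∸ 2) (colDeg j + y ∸ 2) ⟧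

  Φ : ℕ → ℕ → ℕ → ℕ
  Φ j a b = ψ j (colDeg a) (colDeg b)

  colWedges : ℕ → ℕ
  colWedges j = colShape p q (j <ᵇ n) (1 <ᵇ j) (colDeg j) (colDeg (j ∸ 1)) (colDeg (suc j))

  wedges-vertex : ∀ i j → InGrid (i , j) →
    ∑ Vs (λ u → A (i , j) u * LG.others (i , j) u (λ x y → ⟦ degreesAre p q (LG.lineDegree (i , j) u) (LG.lineDegree x y) ⟧))
    ≡ colWedges j
  wedges-vertex i j w∈ = +-cancelʳ-≡ _ _ _ (begin
      Wedge + ∑ Vs (λ u → A w u * g u u)
        ≡⟨ LG.wedges-at w g ⟩
      ∑ Vs (λ u → A w u * ∑ Vs (λ z → A w z * g u z))
        ≡⟨ ∑-cong-All (All.map (λ {u} u∈ → cong (A w u *_) (∑-cong-All (All.map (λ {z} z∈ → cong (A w z *_) (g-grid u∈ z∈)) grid-All))) grid-All) ⟩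
      ∑ Vs (λ u → A w u * ∑ Vs (λ z → A w z * Φ j (proj₂ u) (proj₂ z)))
        ≡⟨ ∑-cong Vs (λ u → cong (A w u *_) (∑-neighbours-column i j w∈ (Φ j (proj₂ u)) (Φ-mirror (colDeg (proj₂ u))))) ⟩
      ∑ Vs (λ u → A w u * N j (Φ j (proj₂ u)))
        ≡⟨ ∑-neighbours-column i j w∈ (λ a → N j (Φ j a)) (λ l 1≤l l≤n → cong (λ x → N j (λ b → ψ j x (colDeg b))) (colDeg-mirror l 1≤l l≤n)) ⟩
      N j (λ a → N j (Φ j a))
        ≡⟨ sym (colProfile-pairs (j <ᵇ n) (1 <ᵇ j)
             (Φ j d d) (Φ j d a) (Φ j d j) (Φ j a d) (Φ j a a) (Φ j a j) (Φ j j d) (Φ j j a) (Φ j j j)) ⟩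
      colWedges j + N j (λ a → Φ j a a)
        ≡⟨ cong (colWedges j +_) (sym diagonal) ⟩
      colWedges j + ∑ Vs (λ u → A w u * g u u) ∎)
    where
      open ≡-Reasoning
      w : Pt
      w = (i , j)
      d a : ℕ
      d = suc j
      a = j ∸ 1
      g : Pt → Pt → ℕ
      g u z = ⟦ degreesAre p q (LG.lineDegree w u) (LG.lineDegree w z) ⟧
      Wedge : ℕ
      Wedge = ∑ Vs (λ u → A w u * LG.others w u (λ x y → ⟦ degreesAre p q (LG.lineDegree w u) (LG.lineDegree x y) ⟧))

      lineDegree-grid : ∀ {u} → InGrid u → LG.lineDegree w u ≡ colDeg j + colDeg (proj₂ u) ∸ 2
      lineDegree-grid u∈ = cong₂ (λ s t → s + t ∸ 2) (deg-grid w w∈) (deg-grid _ u∈)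

      g-grid : ∀ {u z} → InGrid u → InGrid z → g u z ≡ Φ j (proj₂ u) (proj₂ z)
      g-grid u∈ z∈ = cong₂ (λ s t → ⟦ degreesAre p q s t ⟧) (lineDegree-grid u∈) (lineDegree-grid z∈)

      Φ-mirror : ∀ x → Mirror (ψ j x ∘ colDeg)
      Φ-mirror x l 1≤l l≤n = cong (ψ j x) (colDeg-mirror l 1≤l l≤n)

      diagonal : ∑ Vs (λ u → A w u * g u u) ≡ N j (λ a → Φ j a a)
      diagonal = trans (∑-cong-All (All.map (λ {u} u∈ → cong (A w u *_) (g-grid u∈ u∈)) grid-All))
                       (∑-neighbours-column i j w∈ (λ a → Φ j a a) (λ l 1≤l l≤n → cong (λ x → ψ j x x) (colDeg-mirror l 1≤l l≤n)))

  -- every row contributes the same column sum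
  wedgeCount-rows : LG.wedgeCount p q ≡ M * ∑ (range1 n) colWedges
  wedgeCount-rows = begin
      LG.wedgeCount p q
        ≡⟨ ∑-cong-All (All.map (λ {w} w∈ → wedges-vertex (proj₁ w) (proj₂ w) w∈) grid-All) ⟩
      ∑ Vs (λ w → colWedges (proj₂ w))
        ≡⟨ ∑-grid _ ⟩
      ∑ (range1 M) (λ _ → ∑ (range1 n) colWedges)
        ≡⟨ ∑-const (range1 M) _ ⟩
      length (range1 M) * ∑ (range1 n) colWedges
        ≡⟨ cong (_* ∑ (range1 n) colWedges) (trans (length-map suc (upTo M)) (length-applyUpTo id M)) ⟩
      M * ∑ (range1 n) colWedges ∎
    where open ≡-Reasoning

module Columns (m b : ℕ) (m4 : 4 ≤ m) (p q : ℕ) where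
  open Wedges m (4 + b) m4 p q
  open Ladder m (4 + b) m4 using (colDeg)

  O : ℕ → ℕ → ℕ
  O x y = ⟦ degreesAre p q x y ⟧

  O-sym : ∀ x y → O y x ≡ O x y
  O-sym x y = cong ⟦_⟧ (degreesAre-sym p q y x)

  colDeg-inner : ∀ l → 2 ≤ l → l < 4 + b → colDeg l ≡ 4
  colDeg-inner (suc zero)    (s≤s ()) _
  colDeg-inner (suc (suc l)) _ l<n = cong (λ t → ⟦ t ⟧ + 1 + 2) (<ᵇ-true (2 + l) (4 + b) l<n)

  colDeg-last : colDeg (4 + b) ≡ 3
  colDeg-last = cong (λ t → ⟦ t ⟧ + 1 + 2) (<ᵇ-false (4 + b) (4 + b) (n≮n _))

  col-first : colWedges 1 ≡ 4 * O 4 5 + 2 * O 4 4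
  col-first = end-shape (O 4 5) (O 5 4) (O 4 4) (O-sym 4 5)

  col-second : colWedges 2 ≡ 6 * O 5 6 + 6 * O 6 6
  col-second = near-shape (O 5 6) (O 6 5) (O 6 6) (O-sym 5 6)

  col-inner : ∀ t → t < b → colWedges (3 + t) ≡ 12 * O 6 6
  col-inner t t<b = trans (colShape-cong p q (<ᵇ-true (3 + t) (4 + b) (s≤s (s≤s (s≤s (m<n⇒m<1+n t<b))))) refl
                            (colDeg-inner (3 + t) (s≤s (s≤s z≤n)) (s≤s (s≤s (s≤s (m<n⇒m<1+n t<b)))))
                            (colDeg-inner (2 + t) (s≤s (s≤s z≤n)) (s≤s (s≤s (s≤s (≤-trans (n≤1+n t) (m<n⇒m<1+n t<b))))))
                            (colDeg-inner (4 + t) (s≤s (s≤s z≤n)) (s≤s (s≤s (s≤s (s≤s t<b))))))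
                          (inner-shape (O 6 6))

  col-penultimate : colWedges (3 + b) ≡ 6 * O 5 6 + 6 * O 6 6
  col-penultimate = trans (colShape-cong p q (<ᵇ-true (3 + b) (4 + b) ≤-refl) refl
                                (colDeg-inner (3 + b) (s≤s (s≤s z≤n)) ≤-refl)
                                (colDeg-inner (2 + b) (s≤s (s≤s z≤n)) (n≤1+n _)) colDeg-last)
                          (near-shape′ (O 5 6) (O 6 5) (O 6 6) (O-sym 5 6))

  col-last : colWedges (4 + b) ≡ 4 * O 4 5 + 2 * O 4 4
  col-last = trans (colShape-cong p q (<ᵇ-false (4 + b) (4 + b) (n≮n _)) refl colDeg-last
                                  (colDeg-inner (3 + b) (s≤s (s≤s z≤n)) ≤-refl) refl)
                   (end-shape′ (O (1 + D) 5) (O (1 + D) 4) (O 5 (1 + D)) (O 4 (1 + D)) (O 4 5) (O 5 4) (O 4 4) (O-sym 4 5))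
    where
      -- the degree beyond the last column only occurs with a zero factor
      D : ℕ
      D = colDeg (5 + b)

  -- twice the claimed coefficients of one row of m - 1
  rowTotal : ℕ
  rowTotal = O 4 4 * 4 + O 4 5 * 8 + O 5 6 * 12 + O 6 6 * (12 * (1 + b))

  row-sum : ∑ (range1 (4 + b)) colWedges ≡ rowTotal
  row-sum = begin
      ∑ (range1 (4 + b)) colWedges
        ≡⟨ cong (λ l → ∑ l colWedges) (trans (range1-snoc (3 + b)) (cong (_++ [ 4 + b ]) (range1-snoc (2 + b)))) ⟩
      ∑ ((range1 (2 + b) ++ [ 3 + b ]) ++ [ 4 + b ]) colWedges
        ≡⟨ trans (∑-++ (range1 (2 + b) ++ [ 3 + b ]) [ 4 + b ] colWedges) (cong (_+ (colWedges (4 + b) + 0)) (∑-++ (range1 (2 + b)) [ 3 + b ] colWedges)) ⟩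
      colWedges 1 + (colWedges 2 + ∑ inner colWedges) + (colWedges (3 + b) + 0) + (colWedges (4 + b) + 0)
        ≡⟨ cong₂ _+_ (cong₂ _+_ (cong₂ _+_ col-first (cong₂ _+_ col-second inner-sum)) (cong (_+ 0) col-penultimate)) (cong (_+ 0) col-last) ⟩
      (4 * O 4 5 + 2 * O 4 4) + ((6 * O 5 6 + 6 * O 6 6) + b * (12 * O 6 6)) + ((6 * O 5 6 + 6 * O 6 6) + 0) + ((4 * O 4 5 + 2 * O 4 4) + 0)
        ≡⟨ solve 5 (λ b a c e f →
             (con 4 :* c :+ con 2 :* a) :+ ((con 6 :* e :+ con 6 :* f) :+ b :* (con 12 :* f)) :+ ((con 6 :* e :+ con 6 :* f) :+ con 0) :+ ((con 4 :* c :+ con 2 :* a) :+ con 0)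
             := a :* con 4 :+ c :* con 8 :+ e :* con 12 :+ f :* (con 12 :* (con 1 :+ b))) refl b (O 4 4) (O 4 5) (O 5 6) (O 6 6) ⟩
      rowTotal ∎
    where
      open ≡-Reasoning
      inner : List ℕ
      inner = map suc (applyUpTo (λ x → suc (suc x)) b)
      inner-sum : ∑ inner colWedges ≡ b * (12 * O 6 6)
      inner-sum = begin
          ∑ inner colWedges
            ≡⟨ ∑-map suc (applyUpTo (λ x → suc (suc x)) b) colWedges ⟩
          ∑ (applyUpTo (λ x → suc (suc x)) b) (λ x → colWedges (suc x))
            ≡⟨ ∑-cong-All (AllP.applyUpTo⁺₁ (λ x → suc (suc x)) b (λ {t} t<b → col-inner t t<b)) ⟩
          ∑ (applyUpTo (λ x → suc (suc x)) b) (λ _ → 12 * O 6 6)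
            ≡⟨ ∑-const (applyUpTo (λ x → suc (suc x)) b) _ ⟩
          length (applyUpTo (λ x → suc (suc x)) b) * (12 * O 6 6)
            ≡⟨ cong (_* (12 * O 6 6)) (length-applyUpTo _ b) ⟩
          b * (12 * O 6 6) ∎

degreesAre-ordered : ∀ {p q x y} → p ≤ q → x ≤ y → degreesAre p q x y ≡ (p ≡ᵇ x) ∧ (q ≡ᵇ y)
degreesAre-ordered {p} {q} {x} {y} p≤q x≤y = bool-iff to from
  where
    both : p ≡ x → q ≡ y → ((p ≡ᵇ x) ∧ (q ≡ᵇ y)) ≡ true
    both p=x q=y = cong₂ _∧_ (≡ᵇ-true p x p=x) (≡ᵇ-true q y q=y)
    to : degreesAre p q x y ≡ true → ((p ≡ᵇ x) ∧ (q ≡ᵇ y)) ≡ true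
    to e with ∨-true {(x ≡ᵇ p) ∧ (y ≡ᵇ q)} e
    ... | inj₁ e₁ = let (x=p , y=q) = ∧-true e₁ in both (sym (≡ᵇ-sound x p x=p)) (sym (≡ᵇ-sound y q y=q))
    ... | inj₂ e₂ = let (x=q , y=p) = ∧-true e₂
                        x=q = ≡ᵇ-sound x q x=q ; y=p = ≡ᵇ-sound y p y=p
                        p=q = ≤-antisym p≤q (subst₂ _≤_ x=q y=p x≤y)
                    in both (trans p=q (sym x=q)) (trans (sym p=q) (sym y=p))
    from : ((p ≡ᵇ x) ∧ (q ≡ᵇ y)) ≡ true → degreesAre p q x y ≡ true
    from e = let (p=x , q=y) = ∧-true e in
      cong (_∨ ((x ≡ᵇ q) ∧ (y ≡ᵇ p))) (cong₂ _∧_ (≡ᵇ-true x p (sym (≡ᵇ-sound p x p=x))) (≡ᵇ-true y q (sym (≡ᵇ-sound q y q=y))))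

rowOrdered : ℕ → ℕ → ℕ → ℕ
rowOrdered b p q = ⟦ (p ≡ᵇ 4) ∧ (q ≡ᵇ 4) ⟧ * 4 + ⟦ (p ≡ᵇ 4) ∧ (q ≡ᵇ 5) ⟧ * 8
                 + ⟦ (p ≡ᵇ 5) ∧ (q ≡ᵇ 6) ⟧ * 12 + ⟦ (p ≡ᵇ 6) ∧ (q ≡ᵇ 6) ⟧ * (12 * (1 + b))

claimed-rows : ∀ m b p q → p ≤ q → 2 * claimedMPoly m (4 + b) p q ≡ rowOrdered b p q * (m ∸ 1)
claimed-rows m b 0 q _ = refl
claimed-rows m b 1 q _ = refl
claimed-rows m b 2 q _ = refl
claimed-rows m b 3 q _ = refl
claimed-rows m b 4 4 (s≤s (s≤s (s≤s (s≤s _)))) = solve 1 (λ M → con 2 :* (con 2 :* M) := (con 1 :* con 4 :+ con 0 :+ con 0 :+ con 0) :* M) refl (m ∸ 1)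
claimed-rows m b 4 5 (s≤s (s≤s (s≤s (s≤s _)))) = solve 1 (λ M → con 2 :* (con 4 :* M) := (con 0 :+ con 1 :* con 8 :+ con 0 :+ con 0) :* M) refl (m ∸ 1)
claimed-rows m b 4 (suc (suc (suc (suc (suc (suc q)))))) (s≤s (s≤s (s≤s (s≤s _)))) = refl
claimed-rows m b 5 5 (s≤s (s≤s (s≤s (s≤s _)))) = refl
claimed-rows m b 5 6 (s≤s (s≤s (s≤s (s≤s _)))) = solve 1 (λ M → con 2 :* (con 6 :* M) := (con 0 :+ con 0 :+ con 1 :* con 12 :+ con 0) :* M) refl (m ∸ 1)
claimed-rows m b 5 (suc (suc (suc (suc (suc (suc (suc q))))))) (s≤s (s≤s (s≤s (s≤s _)))) = refl
claimed-rows m b 6 5 (s≤s (s≤s (s≤s (s≤s (s≤s ())))))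
claimed-rows m b 6 6 (s≤s (s≤s (s≤s (s≤s _)))) = solve 2 (λ M b → con 2 :* (con 6 :* M :* (con 1 :+ b)) := (con 0 :+ con 0 :+ con 0 :+ con 1 :* (con 12 :* (con 1 :+ b))) :* M) refl (m ∸ 1) b
claimed-rows m b 6 (suc (suc (suc (suc (suc (suc (suc q))))))) (s≤s (s≤s (s≤s (s≤s _)))) = refl
claimed-rows m b (suc (suc (suc (suc (suc (suc (suc p))))))) q _ = refl

rowTotal-ordered : ∀ m b (m4 : 4 ≤ m) p q → p ≤ q → Columns.rowTotal m b m4 p q ≡ rowOrdered b p q
rowTotal-ordered m b m4 p q p≤q =
  cong₂ _+_ (cong₂ _+_ (cong₂ _+_ (weight 4 4 ≤-refl) (weight 4 5 (n≤1+n 4))) (weight 5 6 (n≤1+n 5))) (weight 6 6 ≤-refl)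
  where
    weight : ∀ x y {c} → x ≤ y → ⟦ degreesAre p q x y ⟧ * c ≡ ⟦ (p ≡ᵇ x) ∧ (q ≡ᵇ y) ⟧ * c
    weight x y x≤y = cong (λ t → ⟦ t ⟧ * _) (degreesAre-ordered p≤q x≤y)

theorem3p2 : ∀ m n → 4 ≤ m → 4 ≤ n →
    MPolyEq (MPoly (lineGraph (Mobius m n))) (claimedMPoly m n)
theorem3p2 m (suc (suc (suc (suc b)))) m4 (s≤s (s≤s (s≤s (s≤s z≤n)))) p q p≤q = *-cancelˡ-≡ _ _ 2 (begin
    2 * mCoeff (lineGraph (Mobius m n)) p q   ≡⟨ LG.lineGraph-mCoeff p q ⟩
    LG.wedgeCount p q                         ≡⟨ wedgeCount-rows ⟩
    (m ∸ 1) * ∑ (range1 n) colWedges          ≡⟨ cong ((m ∸ 1) *_) row-sum ⟩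
    (m ∸ 1) * rowTotal                        ≡⟨ cong ((m ∸ 1) *_) (rowTotal-ordered m b m4 p q p≤q) ⟩
    (m ∸ 1) * rowOrdered b p q                ≡⟨ *-comm (m ∸ 1) _ ⟩
    rowOrdered b p q * (m ∸ 1)                ≡⟨ sym (claimed-rows m b p q p≤q) ⟩
    2 * claimedMPoly m n p q                  ∎)
  where
    open ≡-Reasoning
    n : ℕ
    n = 4 + b
    open Columns m b m4 p q
    open Wedges m n m4 p q
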